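{- Let $F$ be a flat in a matroid $M$ that has no loops. If both $M|F$ and $M/F$ are connected, then $F$ is a cyclic interval in any positroid order for $M$.
   Context: A linear order $\leq$ on $E(M)$, for a matroid $M$ of rank $r$ with $|E(M)|=n$, is a positroid order for $M$ if, when the elements are listed in the order $\leq$, there is an $r\times n$ real matrix whose columns (in that order) represent $M$ and all of whose $r\times r$ minors are nonnegative. A cyclic interval of a linear order $\leq$ on $E$ is a set $A\subseteq E$ such that $A$ or $E-A$ is an interval of $\leq$. -}

module Defs where

open import Level using (Level; _⊔_) renaming (suc to lsuc)
open import Data.Nat as ℕ using (ℕ; zero; suc)
open import Data.Bool using (Bool; true; false)
open import Data.Fin using (Fin; toℕ; punchIn) renaming (_<_ to _<ᶠ_; _≤_ to _≤ᶠ_)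
open import Data.Fin.Properties using (any?) renaming (_≟_ to _≟ᶠ_)
open import Data.Fin.Subset
open import Data.Fin.Permutation using (Permutation′; _⟨$⟩ʳ_; _⟨$⟩ˡ_)
open import Data.Vec using (tabulate)
open import Data.Product using (Σ; ∃; _×_; _,_)
open import Data.Sum using (_⊎_)
open import Relation.Nullary using (¬_; does)
open import Relation.Binary using (Rel)
open import Relation.Binary.Structures using (IsTotalOrder)
open import Relation.Binary.PropositionalEquality using (_≡_)
open import Algebra.Bundles using (CommutativeRing)
open import Function.Bundles using (_⇔_)

record Matroid (n : ℕ) : Set where
  field
    rk        : Subset n → ℕ
    rk-bound  : ∀ X → rk X ℕ.≤ ∣ X ∣
    rk-mono   : ∀ X Y → X ⊆ Y → rk X ℕ.≤ rk Y
    rk-submod : ∀ X Y → rk (X ∪ Y) ℕ.+ rk (X ∩ Y) ℕ.≤ rk X ℕ.+ rk Y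

  rank : ℕ
  rank = rk ⊤

module _ {n : ℕ} (M : Matroid n) where
  open Matroid M

  Loopless : Set
  Loopless = ∀ e → rk ⁅ e ⁆ ≡ 1

  IsFlat : Subset n → Set
  IsFlat F = ∀ e → e ∉ F → rk F ℕ.< rk (F ∪ ⁅ e ⁆)

-- A matroid given by a rank function ρ on a ground set S ⊆ Fin n is
-- connected iff it has no 1-separation: for every partition (X, S ─ X)
-- of S into two nonempty parts, ρ X + ρ (S ─ X) > ρ S.
ConnectedOn : {n : ℕ} → (Subset n → ℕ) → Subset n → Set
ConnectedOn ρ S =
  ∀ X → X ⊆ S → Nonempty X → Nonempty (S ─ X) → ρ S ℕ.< ρ X ℕ.+ ρ (S ─ X)

module _ {n : ℕ} (M : Matroid n) where
  open Matroid M

  -- M|F : ground set F, rank function r restricted to subsets of F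
  RestrictionConnected : Subset n → Set
  RestrictionConnected F = ConnectedOn rk F

  -- M/F : ground set E ─ F, rank function X ↦ r(X ∪ F) − r(F)
  ContractionConnected : Subset n → Set
  ContractionConnected F = ConnectedOn (λ X → rk (X ∪ F) ℕ.∸ rk F) (∁ F)

-- Ordered fields (stand-in for ℝ, which agda-stdlib lacks).

record OrderedField (c ℓ₁ ℓ₂ : Level) : Set (lsuc (c ⊔ ℓ₁ ⊔ ℓ₂)) where
  field
    commutativeRing : CommutativeRing c ℓ₁
  open CommutativeRing commutativeRing public
  field
    _≤_          : Rel Carrier ℓ₂
    isTotalOrder : IsTotalOrder _≈_ _≤_
    0≉1          : ¬ (0# ≈ 1#)
    inverse      : ∀ x → ¬ (x ≈ 0#) → ∃ λ y → x * y ≈ 1#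
    +-mono-≤     : ∀ {x y} z → x ≤ y → (x + z) ≤ (y + z)
    *-nonneg     : ∀ {x y} → 0# ≤ x → 0# ≤ y → 0# ≤ (x * y)

module _ {c ℓ₁ ℓ₂} (K : OrderedField c ℓ₁ ℓ₂) where
  open OrderedField K

  Σᶠ : ∀ {m} → (Fin m → Carrier) → Carrier
  Σᶠ {zero}  f = 0#
  Σᶠ {suc m} f = f Fin.zero + Σᶠ (λ i → f (Fin.suc i))

  signed : ℕ → Carrier → Carrier
  signed zero    x = x
  signed (suc k) x = - (signed k x)

  det : ∀ {m} → (Fin m → Fin m → Carrier) → Carrier
  det {zero}  A = 1#
  det {suc m} A =
    Σᶠ (λ j → signed (toℕ j) (A Fin.zero j * det (λ i k → A (Fin.suc i) (punchIn j k))))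

  -- Strictly increasing maps Fin r → Fin n (= r-subsets of positions, listed in order)
  StrictlyIncreasing : ∀ {r m} → (Fin r → Fin m) → Set
  StrictlyIncreasing s = ∀ i j → i <ᶠ j → s i <ᶠ s j

  image : ∀ {r m} → (Fin r → Fin m) → Subset m
  image f = tabulate (λ e → does (any? (λ j → f j ≟ᶠ e)))

  -- The linear order on E = Fin n is given by pos : Permutation′ n,
  -- pos ⟨$⟩ʳ e = position of e.  The matrix A has its columns listed in
  -- that order: column p represents the element pos ⟨$⟩ˡ p.
  -- A (rank-r, r × n) matrix represents M iff for every r-set of columns
  -- the corresponding element set is a basis of M iff its minor is nonzero.
  Represents : ∀ {n} (M : Matroid n) (pos : Permutation′ n) →
               (Fin (Matroid.rank M) → Fin n → Carrier) → Set (ℓ₁)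
  Represents {n} M pos A =
    ∀ (s : Fin (Matroid.rank M) → Fin n) → StrictlyIncreasing s →
      (Matroid.rk M (image (λ j → pos ⟨$⟩ˡ s j)) ≡ Matroid.rank M)
        ⇔ (¬ (det (λ i j → A i (s j)) ≈ 0#))

  AllMinorsNonneg : ∀ {r n} → (Fin r → Fin n → Carrier) → Set ℓ₂
  AllMinorsNonneg {r} {n} A =
    ∀ (s : Fin r → Fin n) → StrictlyIncreasing s → 0# ≤ det (λ i j → A i (s j))

  IsPositroidOrder : ∀ {n} (M : Matroid n) (pos : Permutation′ n) → Set (c ⊔ ℓ₁ ⊔ ℓ₂)
  IsPositroidOrder {n} M pos =
    Σ (Fin (Matroid.rank M) → Fin n → Carrier) λ A → Represents M pos A × AllMinorsNonneg A

IsInterval : ∀ {n} → Permutation′ n → Subset n → Set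
IsInterval pos A =
  ∀ a b x → a ∈ A → b ∈ A →
    (pos ⟨$⟩ʳ a) ≤ᶠ (pos ⟨$⟩ʳ x) → (pos ⟨$⟩ʳ x) ≤ᶠ (pos ⟨$⟩ʳ b) → x ∈ A

IsCyclicInterval : ∀ {n} → Permutation′ n → Subset n → Set
IsCyclicInterval pos A = IsInterval pos A ⊎ IsInterval pos (∁ A)

-- Suppose F is not a cyclic interval. Then some element of F lies strictly between two elements
-- g₁ < g₂ of ∁ F while another element of F lies outside [g₁, g₂]. Connectivity of M|F, applied to
-- the split of F by the window (g₁, g₂), yields a circuit crossing the split, hence a ∈ F outside
-- and c ∈ F inside the window together with a set J₁ such that J₁ ∪ {a} and J₁ ∪ {c} are bases
-- of M|F. The part of ∁ F strictly between a and c contains exactly one of g₁, g₂, so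
-- connectivity of M/F likewise yields b, d ∉ F, with d between a and c and b not, and a set J₂
-- such that J₂ ∪ {b} and J₂ ∪ {d} are bases of M/F. For S = J₁ ∪ J₂ the sets S ∪ {a, b} and
-- S ∪ {c, d} are bases of M, whereas S ∪ {a, c} ⊆ J₁ ∪ {a, c} ∪ J₂ has too small a rank. Since
-- {a, c} and {b, d} interleave in the order, the three-term Plücker relation among the
-- nonnegative maximal minors reads Δ(S ∪ {a, c}) Δ(S ∪ {b, d}) = Δ(S ∪ {a, b}) Δ(S ∪ {c, d}) + p
-- with p ≥ 0, up to a common sign; as Δ(S ∪ {a, b}) Δ(S ∪ {c, d}) > 0, Δ(S ∪ {a, c}) ≠ 0, so
-- S ∪ {a, c} would be a basis.

module Submission where

open import Defs
open import Level using (Level)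
open import Data.Nat using (ℕ)
open import Data.Fin.Subset using (Subset)
open import Data.Fin.Permutation using (Permutation′)

module Subsets where

  open import Level using (Level)
  open import Data.Nat using (ℕ; suc; _+_; _<_)
  open import Data.Nat.Properties using (+-suc; +-comm)
  open import Data.Fin using (Fin)
  open import Data.Fin.Properties using (any?; _≟_)
  open import Data.Fin.Subset
  open import Data.Fin.Subset.Properties
  open import Data.Vec using ([]; _∷_; here; there; tabulate)
  open import Data.Vec.Properties using (lookup∘tabulate; []=⇒lookup; lookup⇒[]=)
  open import Data.Product using (∃; _×_; _,_)
  open import Data.Sum using (_⊎_; inj₁; inj₂)
  open import Data.Empty using (⊥-elim)
  open import Function using (id; _∘_; case_of_)
  open import Relation.Unary using (Pred; Decidable)
  open import Relation.Nullary using (yes; no; ¬?; does)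
  open import Relation.Nullary.Decidable using (_×-dec_; decidable-stable; dec-true)
  open import Relation.Binary.PropositionalEquality
  open import Algebra.Bundles using (CommutativeMonoid)
  import Algebra.Properties.CommutativeSemigroup as CommutativeSemigroupProperties

  private variable
    ℓ : Level
    n : ℕ
    p q : Subset n
    x y : Fin n

  infixl 5 _⊕_

  _⊕_ : Subset n → Fin n → Subset n
  p ⊕ x = p ∪ ⁅ x ⁆

  Disjoint : Subset n → Subset n → Set
  Disjoint p q = ∀ {x} → x ∈ p → x ∉ q

  select : {P : Pred (Fin n) ℓ} → Decidable P → Subset n
  select P? = tabulate (λ x → does (P? x))

  x∈p⊕x : ∀ (p : Subset n) x → x ∈ p ⊕ x
  x∈p⊕x p x = x∈p∪q⁺ (inj₂ (x∈⁅x⁆ x))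

  x∈p⇒x∈p⊕y : x ∈ p → x ∈ p ⊕ y
  x∈p⇒x∈p⊕y x∈p = x∈p∪q⁺ (inj₁ x∈p)

  x∈p⊕y⁻ : ∀ (p : Subset n) y → x ∈ p ⊕ y → x ∈ p ⊎ x ≡ y
  x∈p⊕y⁻ p y x∈p⊕y with x∈p∪q⁻ p ⁅ y ⁆ x∈p⊕y
  ... | inj₁ x∈p = inj₁ x∈p
  ... | inj₂ x∈⁅y⁆ = inj₂ (x∈⁅y⁆⇒x≡y y x∈⁅y⁆)

  x∉p⊕y : x ∉ p → x ≢ y → x ∉ p ⊕ y
  x∉p⊕y {p = p} {y = y} x∉p x≢y x∈p⊕y with x∈p⊕y⁻ p y x∈p⊕y
  ... | inj₁ x∈p = x∉p x∈p
  ... | inj₂ x≡y = x≢y x≡y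

  p⊕x⊆q : p ⊆ q → x ∈ q → p ⊕ x ⊆ q
  p⊕x⊆q {p = p} {x = x} p⊆q x∈q z∈p⊕x with x∈p⊕y⁻ p x z∈p⊕x
  ... | inj₁ z∈p = p⊆q z∈p
  ... | inj₂ refl = x∈q

  ∪-least : ∀ {p q r : Subset n} → p ⊆ r → q ⊆ r → p ∪ q ⊆ r
  ∪-least {p = p} {q} p⊆r q⊆r x∈p∪q with x∈p∪q⁻ p q x∈p∪q
  ... | inj₁ x∈p = p⊆r x∈p
  ... | inj₂ x∈q = q⊆r x∈q

  x∈p─q⁻ : ∀ (p q : Subset n) → x ∈ p ─ q → x ∈ p × x ∉ q
  x∈p─q⁻ (s ∷ p) (t ∷ q) (there x∈p─q) with x∈p─q⁻ p q x∈p─q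
  ... | x∈p , x∉q = there x∈p , λ { (there x∈q) → x∉q x∈q }
  x∈p─q⁻ (inside ∷ p) (outside ∷ q) here = here , λ ()

  module _ {P : Pred (Fin n) ℓ} (P? : Decidable P) where

    ∈-select⁺ : P x → x ∈ select P?
    ∈-select⁺ {x} Px = lookup⇒[]= x (select P?) (trans (lookup∘tabulate (λ y → does (P? y)) x) (dec-true (P? x) Px))

    ∈-select⁻ : x ∈ select P? → P x
    ∈-select⁻ {x} x∈ with P? x | trans (sym (lookup∘tabulate (λ y → does (P? y)) x)) ([]=⇒lookup x∈)
    ... | yes Px | _ = Px
    ... | no _ | ()

  ⊆-or-witness : ∀ (p q : Subset n) → p ⊆ q ⊎ ∃ λ x → x ∈ p × x ∉ q
  ⊆-or-witness p q with any? (λ x → x ∈? p ×-dec ¬? (x ∈? q))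
  ... | yes witness = inj₂ witness
  ... | no ∄ = inj₁ λ {x} x∈p → decidable-stable (x ∈? q) (λ x∉q → ∄ (x , x∈p , x∉q))

  p⊕x≡p : x ∈ p → p ⊕ x ≡ p
  p⊕x≡p {x = x} x∈p = ⊆-antisym (p⊕x⊆q id x∈p) (p⊆p∪q ⁅ x ⁆)

  p-x⊕x≡p : x ∈ p → p - x ⊕ x ≡ p
  p-x⊕x≡p {x = x} {p = p} x∈p = ⊆-antisym (p⊕x⊆q (p─q⊆p p ⁅ x ⁆) x∈p) p⊆p-x⊕x
    where
    p⊆p-x⊕x : p ⊆ p - x ⊕ x
    p⊆p-x⊕x {z} z∈p with z ≟ x
    ... | yes refl = x∈p⊕x (p - x) x
    ... | no z≢x = x∈p⇒x∈p⊕y (x∈p∧x≢y⇒x∈p-y z∈p z≢x)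

  p⊕x⊕y≡p⊕y⊕x : ∀ (p : Subset n) x y → p ⊕ x ⊕ y ≡ p ⊕ y ⊕ x
  p⊕x⊕y≡p⊕y⊕x {n} p x y = xy∙z≈xz∙y p ⁅ x ⁆ ⁅ y ⁆
    where open CommutativeSemigroupProperties (CommutativeMonoid.commutativeSemigroup (∪-commutativeMonoid n))

  [p∪q]⊕x⊕y≡[p⊕x]∪[q⊕y] : ∀ (p q : Subset n) x y → (p ∪ q) ⊕ x ⊕ y ≡ (p ⊕ x) ∪ (q ⊕ y)
  [p∪q]⊕x⊕y≡[p⊕x]∪[q⊕y] {n} p q x y = trans (∪-assoc (p ∪ q) ⁅ x ⁆ ⁅ y ⁆) (interchange p q ⁅ x ⁆ ⁅ y ⁆)
    where open CommutativeSemigroupProperties (CommutativeMonoid.commutativeSemigroup (∪-commutativeMonoid n))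

  ∣p∪q∣≡∣p∣+∣q∣ : ∀ (p q : Subset n) → Disjoint p q → ∣ p ∪ q ∣ ≡ ∣ p ∣ + ∣ q ∣
  ∣p∪q∣≡∣p∣+∣q∣ [] [] _ = refl
  ∣p∪q∣≡∣p∣+∣q∣ (inside ∷ p) (inside ∷ q) disjoint = ⊥-elim (disjoint here here)
  ∣p∪q∣≡∣p∣+∣q∣ (inside ∷ p) (outside ∷ q) disjoint =
    cong suc (∣p∪q∣≡∣p∣+∣q∣ p q (λ x∈p x∈q → disjoint (there x∈p) (there x∈q)))
  ∣p∪q∣≡∣p∣+∣q∣ (outside ∷ p) (inside ∷ q) disjoint =
    trans (cong suc (∣p∪q∣≡∣p∣+∣q∣ p q (λ x∈p x∈q → disjoint (there x∈p) (there x∈q)))) (sym (+-suc _ _))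
  ∣p∪q∣≡∣p∣+∣q∣ (outside ∷ p) (outside ∷ q) disjoint =
    ∣p∪q∣≡∣p∣+∣q∣ p q (λ x∈p x∈q → disjoint (there x∈p) (there x∈q))

  ∣q∣≡∣p∣+∣q─p∣ : ∀ (p q : Subset n) → p ⊆ q → ∣ q ∣ ≡ ∣ p ∣ + ∣ q ─ p ∣
  ∣q∣≡∣p∣+∣q─p∣ [] [] _ = refl
  ∣q∣≡∣p∣+∣q─p∣ (inside ∷ p) (inside ∷ q) p⊆q = cong suc (∣q∣≡∣p∣+∣q─p∣ p q (drop-∷-⊆ p⊆q))
  ∣q∣≡∣p∣+∣q─p∣ (inside ∷ p) (outside ∷ q) p⊆q = case p⊆q here of λ ()
  ∣q∣≡∣p∣+∣q─p∣ (outside ∷ p) (inside ∷ q) p⊆q =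
    trans (cong suc (∣q∣≡∣p∣+∣q─p∣ p q (drop-∷-⊆ p⊆q))) (sym (+-suc _ _))
  ∣q∣≡∣p∣+∣q─p∣ (outside ∷ p) (outside ∷ q) p⊆q = ∣q∣≡∣p∣+∣q─p∣ p q (drop-∷-⊆ p⊆q)

  ∣p⊕x∣≡1+∣p∣ : ∀ (p : Subset n) x → x ∉ p → ∣ p ⊕ x ∣ ≡ suc ∣ p ∣
  ∣p⊕x∣≡1+∣p∣ p x x∉p =
    trans (∣p∪q∣≡∣p∣+∣q∣ p ⁅ x ⁆ (λ z∈p z∈⁅x⁆ → x∉p (subst (_∈ p) (x∈⁅y⁆⇒x≡y x z∈⁅x⁆) z∈p)))
          (trans (cong (∣ p ∣ +_) (∣⁅x⁆∣≡1 x)) (+-comm ∣ p ∣ 1))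

  ∣p⊕x⊕y∣≡2+∣p∣ : ∀ (p : Subset n) {x y} → x ∉ p → y ∉ p → x ≢ y → ∣ p ⊕ x ⊕ y ∣ ≡ suc (suc ∣ p ∣)
  ∣p⊕x⊕y∣≡2+∣p∣ p {x} {y} x∉p y∉p x≢y =
    trans (∣p⊕x∣≡1+∣p∣ (p ⊕ x) y (x∉p⊕y y∉p (x≢y ∘ sym))) (cong suc (∣p⊕x∣≡1+∣p∣ p x x∉p))

  1+∣p-x∣≡∣p∣ : ∀ (p : Subset n) x → x ∈ p → suc ∣ p - x ∣ ≡ ∣ p ∣
  1+∣p-x∣≡∣p∣ p x x∈p = sym (trans (∣q∣≡∣p∣+∣q─p∣ ⁅ x ⁆ p ⁅x⁆⊆p) (cong (_+ ∣ p - x ∣) (∣⁅x⁆∣≡1 x)))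
    where
    ⁅x⁆⊆p : ⁅ x ⁆ ⊆ p
    ⁅x⁆⊆p z∈⁅x⁆ = subst (_∈ p) (sym (x∈⁅y⁆⇒x≡y x z∈⁅x⁆)) x∈p

  ∣p─q⊕x∣<∣p─q∣ : ∀ (p q : Subset n) → x ∈ p → x ∉ q → ∣ p ─ (q ⊕ x) ∣ < ∣ p ─ q ∣
  ∣p─q⊕x∣<∣p─q∣ {x = x} p q x∈p x∉q =
    subst (_< ∣ p ─ q ∣) (cong ∣_∣ (p─q─r≡p─q∪r p q ⁅ x ⁆)) (x∈p⇒∣p-x∣<∣p∣ (x∈p∧x∉q⇒x∈p─q x∈p x∉q))

module Enumeration where

  open import Data.Nat as ℕ using (ℕ; zero; suc; z≤n; s≤s)
  import Data.Nat.Properties as ℕ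
  open import Data.Fin using (Fin; zero; suc; toℕ; punchIn; punchOut; _<_; _≤_)
  import Data.Fin.Properties as Fin
  open import Data.Fin.Subset
  open import Data.Fin.Subset.Properties using (∪-identityʳ)
  open import Data.Vec using ([]; _∷_; here; there)
  open import Data.Product using (∃; _×_; _,_)
  open import Data.Sum using (inj₁; inj₂)
  open import Data.Empty using (⊥-elim)
  open import Relation.Binary using (_Preserves_⟶_; tri<; tri≈; tri>)
  open import Relation.Nullary using (yes; no)
  open import Relation.Binary.PropositionalEquality
  open import Function using (_∘_)
  open Subsets

  private variable
    m n : ℕ

  enum : (T : Subset n) → ∣ T ∣ ≡ m → Fin m → Fin n
  enum [] refl ()
  enum (outside ∷ T) e i = suc (enum T e i)
  enum {m = suc m} (inside ∷ T) e zero = zero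
  enum {m = suc m} (inside ∷ T) e (suc i) = suc (enum T (ℕ.suc-injective e) i)

  enum-increasing : ∀ (T : Subset n) (e : ∣ T ∣ ≡ m) → enum T e Preserves _<_ ⟶ _<_
  enum-increasing [] refl {()}
  enum-increasing (outside ∷ T) e i<j = s≤s (enum-increasing T e i<j)
  enum-increasing {m = suc m} (inside ∷ T) e {zero} {suc j} _ = s≤s z≤n
  enum-increasing {m = suc m} (inside ∷ T) e {suc i} {suc j} (s≤s i<j) = s≤s (enum-increasing T _ i<j)

  enum-∈ : ∀ (T : Subset n) (e : ∣ T ∣ ≡ m) i → enum T e i ∈ T
  enum-∈ [] refl ()
  enum-∈ (outside ∷ T) e i = there (enum-∈ T e i)
  enum-∈ {m = suc m} (inside ∷ T) e zero = here
  enum-∈ {m = suc m} (inside ∷ T) e (suc i) = there (enum-∈ T _ i)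

  enum-surjective : ∀ (T : Subset n) (e : ∣ T ∣ ≡ m) {x} → x ∈ T → ∃ λ i → enum T e i ≡ x
  enum-surjective (outside ∷ T) e (there x∈T) with enum-surjective T e x∈T
  ... | i , refl = i , refl
  enum-surjective {m = suc m} (inside ∷ T) e here = zero , refl
  enum-surjective {m = suc m} (inside ∷ T) e (there x∈T) with enum-surjective T (ℕ.suc-injective e) x∈T
  ... | i , refl = suc i , refl

  countBelow : Subset n → Fin n → ℕ
  countBelow (_ ∷ T) zero = 0
  countBelow (inside ∷ T) (suc x) = suc (countBelow T x)
  countBelow (outside ∷ T) (suc x) = countBelow T x

  toℕ-enum : ∀ (T : Subset n) (e : ∣ T ∣ ≡ m) i → toℕ i ≡ countBelow T (enum T e i)
  toℕ-enum [] refl ()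
  toℕ-enum (outside ∷ T) e i = toℕ-enum T e i
  toℕ-enum {m = suc m} (inside ∷ T) e zero = refl
  toℕ-enum {m = suc m} (inside ∷ T) e (suc i) = cong suc (toℕ-enum T _ i)

  countBelow-⊕< : ∀ (T : Subset n) {x y} → x ∉ T → x < y → countBelow (T ⊕ x) y ≡ suc (countBelow T y)
  countBelow-⊕< (inside ∷ T) {zero} x∉T _ = ⊥-elim (x∉T here)
  countBelow-⊕< (outside ∷ T) {zero} {suc y} _ _ rewrite ∪-identityʳ T = refl
  countBelow-⊕< (inside ∷ T) {suc x} {suc y} x∉T (s≤s x<y) =
    cong suc (countBelow-⊕< T (λ x∈T → x∉T (there x∈T)) x<y)
  countBelow-⊕< (outside ∷ T) {suc x} {suc y} x∉T (s≤s x<y) =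
    countBelow-⊕< T (λ x∈T → x∉T (there x∈T)) x<y

  countBelow-⊕≥ : ∀ (T : Subset n) {x y} → y ≤ x → countBelow (T ⊕ x) y ≡ countBelow T y
  countBelow-⊕≥ (_ ∷ T) {zero} {zero} _ = refl
  countBelow-⊕≥ (_ ∷ T) {suc x} {zero} _ = refl
  countBelow-⊕≥ (inside ∷ T) {suc x} {suc y} (s≤s y≤x) = cong suc (countBelow-⊕≥ T y≤x)
  countBelow-⊕≥ (outside ∷ T) {suc x} {suc y} (s≤s y≤x) = countBelow-⊕≥ T y≤x

  module _ {s : Fin m → Fin n} (s-incr : s Preserves _<_ ⟶ _<_) where

    increasing⇒injective : ∀ {i j} → s i ≡ s j → i ≡ j
    increasing⇒injective {i} {j} si≡sj with Fin.<-cmp i j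
    ... | tri< i<j _ _ = ⊥-elim (Fin.<-irrefl si≡sj (s-incr i<j))
    ... | tri≈ _ i≡j _ = i≡j
    ... | tri> _ _ j<i = ⊥-elim (Fin.<-irrefl (sym si≡sj) (s-incr j<i))

    increasing⇒monotone : ∀ {i j} → i ≤ j → s i ≤ s j
    increasing⇒monotone {i} {j} i≤j with i Fin.≟ j
    ... | yes refl = Fin.≤-refl
    ... | no i≢j = ℕ.<⇒≤ (s-incr (Fin.≤∧≢⇒< i≤j i≢j))

  private
    increasing-head : ∀ {s t : Fin (suc m) → Fin n} →
      s Preserves _<_ ⟶ _<_ → t Preserves _<_ ⟶ _<_ →
      (∀ i → ∃ λ j → s i ≡ t j) → (∀ j → ∃ λ i → t j ≡ s i) → s zero ≡ t zero
    increasing-head {s = s} {t} s↑ t↑ s⊆t t⊆s with s⊆t zero | t⊆s zero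
    ... | j , s₀≡tⱼ | i , t₀≡sᵢ = Fin.≤-antisym
      (subst (s zero ≤_) (sym t₀≡sᵢ) (increasing⇒monotone s↑ z≤n))
      (subst (t zero ≤_) (sym s₀≡tⱼ) (increasing⇒monotone t↑ z≤n))

    increasing-tail : ∀ {s t : Fin (suc m) → Fin (suc n)} → s Preserves _<_ ⟶ _<_ → s zero ≡ t zero →
      (∀ i → ∃ λ j → s i ≡ t j) → ∀ i → ∃ λ j → s (suc i) ≡ t (suc j)
    increasing-tail {s = s} s↑ s₀≡t₀ s⊆t i with s⊆t (suc i)
    ... | zero , sᵢ₊₁≡t₀ = ⊥-elim (Fin.<-irrefl (trans s₀≡t₀ (sym sᵢ₊₁≡t₀)) (s↑ (s≤s z≤n)))
    ... | suc j , sᵢ₊₁≡tⱼ₊₁ = j , sᵢ₊₁≡tⱼ₊₁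

  increasing-unique : ∀ {s t : Fin m → Fin n} → s Preserves _<_ ⟶ _<_ → t Preserves _<_ ⟶ _<_ →
    (∀ i → ∃ λ j → s i ≡ t j) → (∀ j → ∃ λ i → t j ≡ s i) → ∀ i → s i ≡ t i
  increasing-unique s↑ t↑ s⊆t t⊆s zero = increasing-head s↑ t↑ s⊆t t⊆s
  increasing-unique {n = zero} {s = s} _ _ _ _ (suc i) = ⊥-elim (Fin.¬Fin0 (s zero))
  increasing-unique {n = suc n} s↑ t↑ s⊆t t⊆s (suc i) =
    increasing-unique (λ i<j → s↑ (s≤s i<j)) (λ i<j → t↑ (s≤s i<j))
      (increasing-tail s↑ s₀≡t₀ s⊆t) (increasing-tail t↑ (sym s₀≡t₀) t⊆s) i
    where s₀≡t₀ = increasing-head s↑ t↑ s⊆t t⊆s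

  punchIn-increasing : ∀ (p : Fin (suc n)) → punchIn p Preserves _<_ ⟶ _<_
  punchIn-increasing p {i} {j} i<j = Fin.≤∧≢⇒< (Fin.punchIn-mono-≤ p i j (ℕ.<⇒≤ i<j))
    (λ pᵢ≡pⱼ → Fin.<-irrefl (Fin.punchIn-injective p i j pᵢ≡pⱼ) i<j)

  enum-punchIn : ∀ (T : Subset n) {x} → x ∉ T → (e : ∣ T ∣ ≡ m) (e′ : ∣ T ⊕ x ∣ ≡ suc m) →
    ∀ {p} → enum (T ⊕ x) e′ p ≡ x → ∀ i → enum (T ⊕ x) e′ (punchIn p i) ≡ enum T e i
  enum-punchIn T {x} x∉T e e′ {p} eₚ≡x =
    increasing-unique (λ i<j → enum-increasing (T ⊕ x) e′ (punchIn-increasing p i<j)) (enum-increasing T e) into onto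
    where
    into : ∀ i → ∃ λ j → enum (T ⊕ x) e′ (punchIn p i) ≡ enum T e j
    into i with x∈p⊕y⁻ T x (enum-∈ (T ⊕ x) e′ (punchIn p i))
    ... | inj₁ z∈T with enum-surjective T e z∈T
    ...   | j , eⱼ≡z = j , sym eⱼ≡z
    into i | inj₂ z≡x =
      ⊥-elim (Fin.punchInᵢ≢i p i (increasing⇒injective (enum-increasing (T ⊕ x) e′) (trans z≡x (sym eₚ≡x))))
    onto : ∀ j → ∃ λ i → enum T e j ≡ enum (T ⊕ x) e′ (punchIn p i)
    onto j with enum-surjective (T ⊕ x) e′ (x∈p⇒x∈p⊕y (enum-∈ T e j))
    ... | k , eₖ≡eⱼ = punchOut p≢k , trans (sym eₖ≡eⱼ) (cong (enum (T ⊕ x) e′) (sym (Fin.punchIn-punchOut p≢k)))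
      where
      p≢k : p ≢ k
      p≢k refl = x∉T (subst (_∈ T) (trans (sym eₖ≡eⱼ) eₚ≡x) (enum-∈ T e j))

  enum-position : ∀ (T : Subset n) {y} (e : ∣ T ⊕ y ∣ ≡ m) →
    ∃ λ p → enum (T ⊕ y) e p ≡ y × toℕ p ≡ countBelow T y
  enum-position T {y} e with enum-surjective (T ⊕ y) e (x∈p⊕x T y)
  ... | p , eₚ≡y = p , eₚ≡y , trans (toℕ-enum (T ⊕ y) e p) (trans (cong (countBelow (T ⊕ y)) eₚ≡y) (countBelow-⊕≥ T Fin.≤-refl))

  -- d lies strictly between a and c, and b does not.
  data Interleaved {n} (a b c d : Fin n) : Set where
    b<a<d<c : b < a → a < d → d < c → Interleaved a b c d
    a<d<c<b : a < d → d < c → c < b → Interleaved a b c d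
    b<c<d<a : b < c → c < d → d < a → Interleaved a b c d
    c<d<a<b : c < d → d < a → a < b → Interleaved a b c d

  interleaved⇒≢ : ∀ {n} {a b c d : Fin n} → Interleaved a b c d → a ≢ c
  interleaved⇒≢ (b<a<d<c _ a<d d<c) = Fin.<⇒≢ (Fin.<-trans a<d d<c)
  interleaved⇒≢ (a<d<c<b a<d d<c _) = Fin.<⇒≢ (Fin.<-trans a<d d<c)
  interleaved⇒≢ (b<c<d<a _ c<d d<a) = Fin.<⇒≢ (Fin.<-trans c<d d<a) ∘ sym
  interleaved⇒≢ (c<d<a<b c<d d<a _) = Fin.<⇒≢ (Fin.<-trans c<d d<a) ∘ sym

module Positions {n : ℕ} (pos : Permutation′ n) where

  open import Data.Nat using (suc)
  open import Data.Fin.Permutation using (_⟨$⟩ʳ_; _⟨$⟩ˡ_; inverseˡ; inverseʳ; flip)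
  open import Data.Bool using (Bool; true; false)
  open import Data.Nat.Properties using (+-0-commutativeMonoid)
  open import Data.Fin using (Fin)
  open import Data.Fin.Subset
  open import Data.Fin.Subset.Properties using (⊆-antisym)
  open import Data.Sum using (inj₁; inj₂)
  open import Data.Vec using (_∷_; []; lookup; tabulate)
  open import Data.Vec.Properties using (lookup∘tabulate; []=⇒lookup; lookup⇒[]=)
  open import Function using (_∘_)
  open import Relation.Binary.PropositionalEquality
  open Subsets
  open import Algebra.Properties.CommutativeMonoid.Sum +-0-commutativeMonoid using (sum; sum-permute; sum-cong-≗)

  position : Fin n → Fin n
  position x = pos ⟨$⟩ʳ x

  element : Fin n → Fin n
  element p = pos ⟨$⟩ˡ p

  element-position : ∀ x → element (position x) ≡ x
  element-position x = inverseˡ pos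

  position-element : ∀ p → position (element p) ≡ p
  position-element p = inverseʳ pos

  position-injective : ∀ {x y} → position x ≡ position y → x ≡ y
  position-injective {x} {y} eq = trans (sym (element-position x)) (trans (cong element eq) (element-position y))

  positions : Subset n → Subset n
  positions T = tabulate (lookup T ∘ element)

  ∈-positions⁺ : ∀ {T x} → x ∈ T → position x ∈ positions T
  ∈-positions⁺ {T} {x} x∈T = lookup⇒[]= (position x) (positions T)
    (trans (lookup∘tabulate (lookup T ∘ element) (position x))
           (trans (cong (lookup T) (element-position x)) ([]=⇒lookup x∈T)))

  ∈-positions⁻ : ∀ {T p} → p ∈ positions T → element p ∈ T
  ∈-positions⁻ {T} {p} p∈ = lookup⇒[]= (element p) T
    (trans (sym (lookup∘tabulate (lookup T ∘ element) p)) ([]=⇒lookup p∈))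

  ∉-positions : ∀ {T x} → x ∉ T → position x ∉ positions T
  ∉-positions {T} {x} x∉T p∈ = x∉T (subst (_∈ T) (element-position x) (∈-positions⁻ p∈))

  private
    indicator : Bool → ℕ
    indicator true = 1
    indicator false = 0

    ∣p∣≡sum : ∀ {k} (p : Subset k) → ∣ p ∣ ≡ sum (indicator ∘ lookup p)
    ∣p∣≡sum [] = refl
    ∣p∣≡sum (inside ∷ p) = cong suc (∣p∣≡sum p)
    ∣p∣≡sum (outside ∷ p) = ∣p∣≡sum p

  ∣positions∣ : ∀ T → ∣ positions T ∣ ≡ ∣ T ∣
  ∣positions∣ T = begin
    ∣ positions T ∣                         ≡⟨ ∣p∣≡sum (positions T) ⟩
    sum (indicator ∘ lookup (positions T))  ≡⟨ sum-cong-≗ (cong indicator ∘ lookup∘tabulate (lookup T ∘ element)) ⟩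
    sum (indicator ∘ lookup T ∘ element)    ≡⟨ sum-permute (indicator ∘ lookup T) (flip pos) ⟨
    sum (indicator ∘ lookup T)              ≡⟨ ∣p∣≡sum T ⟨
    ∣ T ∣                                   ∎
    where open ≡-Reasoning

  positions-⊕ : ∀ T x → positions (T ⊕ x) ≡ positions T ⊕ position x
  positions-⊕ T x = ⊆-antisym lhs⊆rhs rhs⊆lhs
    where
    lhs⊆rhs : positions (T ⊕ x) ⊆ positions T ⊕ position x
    lhs⊆rhs {p} p∈ with x∈p⊕y⁻ T x (∈-positions⁻ {T ⊕ x} p∈)
    ... | inj₁ element-p∈T = x∈p⇒x∈p⊕y {p = positions T} {y = position x}
      (subst (_∈ positions T) (position-element p) (∈-positions⁺ {T} element-p∈T))
    ... | inj₂ element-p≡x = subst (_∈ positions T ⊕ position x)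
      (trans (cong position (sym element-p≡x)) (position-element p)) (x∈p⊕x (positions T) (position x))
    rhs⊆lhs : positions T ⊕ position x ⊆ positions (T ⊕ x)
    rhs⊆lhs {p} p∈ with x∈p⊕y⁻ (positions T) (position x) p∈
    ... | inj₁ p∈positions-T = subst (_∈ positions (T ⊕ x)) (position-element p)
      (∈-positions⁺ {T ⊕ x} (x∈p⇒x∈p⊕y {p = T} {y = x} (∈-positions⁻ {T} p∈positions-T)))
    ... | inj₂ p≡position-x = subst (_∈ positions (T ⊕ x)) (sym p≡position-x) (∈-positions⁺ {T ⊕ x} (x∈p⊕x T x))

module OrderedFieldFacts {c ℓ₁ ℓ₂} (K : OrderedField c ℓ₁ ℓ₂) where

  open import Data.Product using (_×_; _,_)
  open import Data.Sum using (_⊎_; inj₁; inj₂)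
  open import Relation.Nullary using (¬_)
  open import Relation.Binary.Structures using (IsTotalOrder)

  open OrderedField K
  open import Algebra.Properties.Ring ring using (-1*x≈-x; -‿involutive)
  open import Relation.Binary.Reasoning.Setoid setoid
  private module ≤ = IsTotalOrder isTotalOrder

  ≤-respˡʳ-≈ : ∀ {x y x′ y′} → x ≈ x′ → y ≈ y′ → x ≤ y → x′ ≤ y′
  ≤-respˡʳ-≈ x≈x′ y≈y′ x≤y = ≤.≲-respˡ-≈ x≈x′ (≤.≲-respʳ-≈ y≈y′ x≤y)

  0≤1 : 0# ≤ 1#
  0≤1 with ≤.total 0# 1#
  ... | inj₁ 0≤1 = 0≤1
  ... | inj₂ 1≤0 = ≤-respˡʳ-≈ refl (trans (-1*x≈-x (- 1#)) (-‿involutive 1#)) (*-nonneg 0≤-1 0≤-1)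
    where
    0≤-1 : 0# ≤ (- 1#)
    0≤-1 = ≤-respˡʳ-≈ (-‿inverseʳ 1#) (+-identityˡ (- 1#)) (+-mono-≤ (- 1#) 1≤0)

  1+1≉0 : ¬ 1# + 1# ≈ 0#
  1+1≉0 2≈0 = 0≉1 (≤.antisym 0≤1 (≤-respˡʳ-≈ (+-identityˡ 1#) 2≈0 (+-mono-≤ 1# 0≤1)))

  x≈-x⇒x≈0 : ∀ {x} → x ≈ - x → x ≈ 0#
  x≈-x⇒x≈0 {x} x≈-x with inverse (1# + 1#) 1+1≉0
  ... | ½ , 2*½≈1 = begin
    x                    ≈⟨ *-identityˡ x ⟨
    1# * x               ≈⟨ *-congʳ (trans (sym 2*½≈1) (*-comm _ ½)) ⟩
    (½ * (1# + 1#)) * x  ≈⟨ *-assoc ½ _ x ⟩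
    ½ * ((1# + 1#) * x)  ≈⟨ *-congˡ (distribʳ x 1# 1#) ⟩
    ½ * (1# * x + 1# * x) ≈⟨ *-congˡ (+-cong (*-identityˡ x) (trans (*-identityˡ x) x≈-x)) ⟩
    ½ * (x + - x)        ≈⟨ *-congˡ (-‿inverseʳ x) ⟩
    ½ * 0#               ≈⟨ zeroʳ ½ ⟩
    0#                   ∎

  *-nonzero : ∀ {x y} → ¬ x ≈ 0# → ¬ y ≈ 0# → ¬ x * y ≈ 0#
  *-nonzero {x} {y} x≉0 y≉0 xy≈0 with inverse x x≉0
  ... | x⁻¹ , x*x⁻¹≈1 = y≉0 (begin
    y              ≈⟨ *-identityˡ y ⟨
    1# * y         ≈⟨ *-congʳ (trans (sym x*x⁻¹≈1) (*-comm x x⁻¹)) ⟩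
    (x⁻¹ * x) * y  ≈⟨ *-assoc x⁻¹ x y ⟩
    x⁻¹ * (x * y)  ≈⟨ *-congˡ xy≈0 ⟩
    x⁻¹ * 0#       ≈⟨ zeroʳ x⁻¹ ⟩
    0#             ∎)

  nonneg-+≈0⇒≈0 : ∀ {x y} → 0# ≤ x → 0# ≤ y → x + y ≈ 0# → x ≈ 0#
  nonneg-+≈0⇒≈0 {x} {y} 0≤x 0≤y x+y≈0 =
    ≤.antisym (≤-respˡʳ-≈ (+-identityˡ x) (trans (+-comm y x) x+y≈0) (+-mono-≤ x 0≤y)) 0≤x

  nonneg-+-nonzero : ∀ {x y} → 0# ≤ x → 0# ≤ y → (¬ x ≈ 0#) ⊎ (¬ y ≈ 0#) → ¬ x + y ≈ 0#
  nonneg-+-nonzero 0≤x 0≤y (inj₁ x≉0) x+y≈0 = x≉0 (nonneg-+≈0⇒≈0 0≤x 0≤y x+y≈0)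
  nonneg-+-nonzero {x} {y} 0≤x 0≤y (inj₂ y≉0) x+y≈0 = y≉0 (nonneg-+≈0⇒≈0 0≤y 0≤x (trans (+-comm y x) x+y≈0))

  *-nonzero⁻ : ∀ {x y} → ¬ x * y ≈ 0# → ¬ x ≈ 0# × ¬ y ≈ 0#
  *-nonzero⁻ {x} {y} xy≉0 = (λ x≈0 → xy≉0 (trans (*-congʳ x≈0) (zeroˡ y))) , (λ y≈0 → xy≉0 (trans (*-congˡ y≈0) (zeroʳ x)))

module Determinants {c ℓ₁ ℓ₂} (K : OrderedField c ℓ₁ ℓ₂) where

  open import Data.Nat as ℕ using (ℕ; zero; suc)
  import Data.Nat.Properties as ℕ
  open import Data.Fin using (Fin; zero; suc; toℕ; punchIn; pinch)
  open import Data.Vec.Functional using (Vector; _∷_)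
  open import Function using (_∘_)
  import Relation.Binary.PropositionalEquality as ≡
  open ≡ using (_≡_)

  open OrderedField K hiding (zero)
  open import Algebra.Properties.Ring ring using (-‿involutive; -‿distribˡ-*; -‿distribʳ-*; -‿+-comm; -0#≈0#; x∙y⁻¹≈ε⇒x≈y)
  open import Algebra.Properties.Semiring.Sum semiring
    using (sum; sum-syntax; sum-cong-≋; ∑-comm; ∑-distrib-+; *-distribˡ-sum; sum-replicate-zero)
  open import Algebra.Properties.CommutativeSemigroup *-commutativeSemigroup using (x∙yz≈y∙xz; x∙yz≈z∙yx)
  open import Algebra.Properties.CommutativeSemigroup +-commutativeSemigroup
    using () renaming (x∙yz≈y∙xz to x+[y+z]≈y+[x+z])
  open import Relation.Binary.Reasoning.Setoid setoid
  open OrderedFieldFacts K using (x≈-x⇒x≈0)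

  private variable
    m : ℕ

  Row : ℕ → Set c
  Row = Vector Carrier

  Matrix : ℕ → Set c
  Matrix m = Fin m → Row m

  minor : Matrix (suc m) → Fin (suc m) → Fin (suc m) → Matrix m
  minor A i j r k = A (punchIn i r) (punchIn j k)

  signed-cong : ∀ k {x y} → x ≈ y → signed K k x ≈ signed K k y
  signed-cong zero x≈y = x≈y
  signed-cong (suc k) x≈y = -‿cong (signed-cong k x≈y)

  signed-*ˡ : ∀ k x y → signed K k (x * y) ≈ signed K k x * y
  signed-*ˡ zero x y = refl
  signed-*ˡ (suc k) x y = trans (-‿cong (signed-*ˡ k x y)) (-‿distribˡ-* _ y)

  signed-*ʳ : ∀ k x y → signed K k (x * y) ≈ x * signed K k y
  signed-*ʳ zero x y = refl
  signed-*ʳ (suc k) x y = trans (-‿cong (signed-*ʳ k x y)) (-‿distribʳ-* x _)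

  signed-+ : ∀ k x y → signed K k (x + y) ≈ signed K k x + signed K k y
  signed-+ zero x y = refl
  signed-+ (suc k) x y = trans (-‿cong (signed-+ k x y)) (sym (-‿+-comm _ _))

  signed-0 : ∀ k → signed K k 0# ≈ 0#
  signed-0 zero = refl
  signed-0 (suc k) = trans (-‿cong (signed-0 k)) -0#≈0#

  signed-‿-comm : ∀ k x → signed K k (- x) ≈ - signed K k x
  signed-‿-comm zero x = refl
  signed-‿-comm (suc k) x = -‿cong (signed-‿-comm k x)

  signed-exponent-+ : ∀ k l x → signed K (k ℕ.+ l) x ≡ signed K k (signed K l x)
  signed-exponent-+ zero l x = ≡.refl
  signed-exponent-+ (suc k) l x = ≡.cong -_ (signed-exponent-+ k l x)

  signed-exponent-cong : ∀ {k l} x → k ≡ l → signed K k x ≈ signed K l x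
  signed-exponent-cong x ≡.refl = refl

  signed-comm : ∀ k l x → signed K k (signed K l x) ≈ signed K l (signed K k x)
  signed-comm k l x = begin
    signed K k (signed K l x) ≡⟨ signed-exponent-+ k l x ⟨
    signed K (k ℕ.+ l) x      ≈⟨ signed-exponent-cong x (ℕ.+-comm k l) ⟩
    signed K (l ℕ.+ k) x      ≡⟨ signed-exponent-+ l k x ⟩
    signed K l (signed K k x) ∎

  signed-involutive : ∀ k x → signed K k (signed K k x) ≈ x
  signed-involutive zero x = refl
  signed-involutive (suc k) x = trans (-‿cong (signed-‿-comm k _)) (trans (-‿involutive _) (signed-involutive k x))

  signed-∑ : ∀ k (f : Vector Carrier m) → signed K k (sum f) ≈ ∑[ i < m ] signed K k (f i)
  signed-∑ {zero} k f = signed-0 k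
  signed-∑ {suc m} k f = trans (signed-+ k (f zero) (sum (f ∘ suc))) (+-congˡ (signed-∑ k (f ∘ suc)))

  signed-*-∑ : ∀ k x (w : Vector Carrier m) →
    signed K k (x * ∑[ q < m ] signed K (toℕ q) (w q)) ≈ ∑[ q < m ] signed K (k ℕ.+ toℕ q) (x * w q)
  signed-*-∑ {m} k x w = begin
    signed K k (x * ∑[ q < m ] signed K (toℕ q) (w q))   ≈⟨ signed-cong k (*-distribˡ-sum x (λ q → signed K (toℕ q) (w q))) ⟩
    signed K k (∑[ q < m ] (x * signed K (toℕ q) (w q)))   ≈⟨ signed-∑ k (λ q → x * signed K (toℕ q) (w q)) ⟩
    ∑[ q < m ] signed K k (x * signed K (toℕ q) (w q))   ≈⟨ sum-cong-≋ (λ q → signed-cong k (signed-*ʳ (toℕ q) x (w q))) ⟨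
    ∑[ q < m ] signed K k (signed K (toℕ q) (x * w q))   ≈⟨ sum-cong-≋ (λ q → reflexive (signed-exponent-+ k (toℕ q) (x * w q))) ⟨
    ∑[ q < m ] signed K (k ℕ.+ toℕ q) (x * w q)          ∎

  signed-suc-+-suc : ∀ a b x → signed K (suc a ℕ.+ suc b) x ≈ signed K (a ℕ.+ b) x
  signed-suc-+-suc a b x = trans (-‿cong (signed-exponent-cong x (ℕ.+-suc a b))) (-‿involutive _)

  ∑-*-signed : ∀ p (x D : Vector Carrier m) →
    ∑[ k < m ] signed K (toℕ k) (x k * signed K p (D k)) ≈ signed K p (∑[ k < m ] signed K (toℕ k) (x k * D k))
  ∑-*-signed {m} p x D = begin
    ∑[ k < m ] signed K (toℕ k) (x k * signed K p (D k))
      ≈⟨ sum-cong-≋ (λ k → signed-cong (toℕ k) (signed-*ʳ p (x k) (D k))) ⟨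
    ∑[ k < m ] signed K (toℕ k) (signed K p (x k * D k))
      ≈⟨ sum-cong-≋ (λ k → signed-comm (toℕ k) p (x k * D k)) ⟩
    ∑[ k < m ] signed K p (signed K (toℕ k) (x k * D k))
      ≈⟨ signed-∑ p (λ k → signed K (toℕ k) (x k * D k)) ⟨
    signed K p (∑[ k < m ] signed K (toℕ k) (x k * D k)) ∎

  signed-*-signed : ∀ k l x y → signed K k x * signed K l y ≈ signed K (k ℕ.+ l) (x * y)
  signed-*-signed k l x y = begin
    signed K k x * signed K l y    ≈⟨ signed-*ˡ k x (signed K l y) ⟨
    signed K k (x * signed K l y)  ≈⟨ signed-cong k (signed-*ʳ l x y) ⟨
    signed K k (signed K l (x * y)) ≡⟨ signed-exponent-+ k l (x * y) ⟨
    signed K (k ℕ.+ l) (x * y)     ∎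

  Σᶠ≡sum : ∀ (f : Vector Carrier m) → Σᶠ K f ≡ sum f
  Σᶠ≡sum {zero} f = ≡.refl
  Σᶠ≡sum {suc m} f = ≡.cong (f zero +_) (Σᶠ≡sum (f ∘ suc))

  det-expand : ∀ (A : Matrix (suc m)) →
    det K A ≈ ∑[ j < suc m ] signed K (toℕ j) (A zero j * det K (minor A zero j))
  det-expand A = reflexive (Σᶠ≡sum (λ j → signed K (toℕ j) (A zero j * det K (minor A zero j))))

  det-cong : ∀ {A B : Matrix m} → (∀ i j → A i j ≈ B i j) → det K A ≈ det K B
  det-cong {zero} A≈B = refl
  det-cong {suc m} {A} {B} A≈B = begin
    det K A  ≈⟨ det-expand A ⟩
    _        ≈⟨ sum-cong-≋ (λ j → signed-cong (toℕ j) (*-cong (A≈B zero j) (det-cong (λ r k → A≈B (suc r) (punchIn j k))))) ⟩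
    _        ≈⟨ det-expand B ⟨
    det K B  ∎

  det-expand-col : ∀ (A : Matrix (suc m)) →
    det K A ≈ ∑[ i < suc m ] signed K (toℕ i) (A i zero * det K (minor A i zero))
  det-expand-col {zero} A = refl
  det-expand-col {suc m} A = trans (det-expand A) (+-congˡ (begin
    ∑[ j < suc m ] signed K (suc (toℕ j)) (A zero (suc j) * det K (minor A zero (suc j)))
      ≈⟨ sum-cong-≋ (λ j → signed-cong (suc (toℕ j)) (*-congˡ {A zero (suc j)} (det-expand-col (minor A zero (suc j))))) ⟩
    ∑[ j < suc m ] signed K (suc (toℕ j)) (A zero (suc j) * ∑[ i < suc m ] signed K (toℕ i) (A (suc i) zero * X i j))
      ≈⟨ sum-cong-≋ (λ j → signed-*-∑ (suc (toℕ j)) (A zero (suc j)) (λ i → A (suc i) zero * X i j)) ⟩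
    ∑[ j < suc m ] ∑[ i < suc m ] signed K (suc (toℕ j ℕ.+ toℕ i)) (A zero (suc j) * (A (suc i) zero * X i j))
      ≈⟨ ∑-comm (λ j i → signed K (suc (toℕ j ℕ.+ toℕ i)) (A zero (suc j) * (A (suc i) zero * X i j))) ⟩
    ∑[ i < suc m ] ∑[ j < suc m ] signed K (suc (toℕ j ℕ.+ toℕ i)) (A zero (suc j) * (A (suc i) zero * X i j))
      ≈⟨ sum-cong-≋ (λ i → sum-cong-≋ (λ j → trans
           (signed-exponent-cong (A zero (suc j) * (A (suc i) zero * X i j)) (≡.cong suc (ℕ.+-comm (toℕ j) (toℕ i))))
           (signed-cong (suc (toℕ i ℕ.+ toℕ j)) (x∙yz≈y∙xz (A zero (suc j)) (A (suc i) zero) (X i j))))) ⟩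
    ∑[ i < suc m ] ∑[ j < suc m ] signed K (suc (toℕ i ℕ.+ toℕ j)) (A (suc i) zero * (A zero (suc j) * X i j))
      ≈⟨ sum-cong-≋ (λ i → signed-*-∑ (suc (toℕ i)) (A (suc i) zero) (λ j → A zero (suc j) * X i j)) ⟨
    ∑[ i < suc m ] signed K (suc (toℕ i)) (A (suc i) zero * ∑[ j < suc m ] signed K (toℕ j) (A zero (suc j) * X i j))
      ≈⟨ sum-cong-≋ (λ i → signed-cong (suc (toℕ i)) (*-congˡ {A (suc i) zero} (det-expand (minor A (suc i) zero)))) ⟨
    ∑[ i < suc m ] signed K (suc (toℕ i)) (A (suc i) zero * det K (minor A (suc i) zero)) ∎))
    where
    X : Fin (suc m) → Fin (suc m) → Carrier
    X i j = det K (λ r k → A (suc (punchIn i r)) (suc (punchIn j k)))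

  det-transpose : ∀ (A : Matrix m) → det K (λ i j → A j i) ≈ det K A
  det-transpose {zero} A = refl
  det-transpose {suc m} A = begin
    det K (λ i j → A j i)
      ≈⟨ det-expand (λ i j → A j i) ⟩
    ∑[ j < suc m ] signed K (toℕ j) (A j zero * det K (λ r k → A (punchIn j k) (suc r)))
      ≈⟨ sum-cong-≋ (λ j → signed-cong (toℕ j) (*-congˡ {A j zero} (det-transpose (minor A j zero)))) ⟩
    ∑[ j < suc m ] signed K (toℕ j) (A j zero * det K (minor A j zero))
      ≈⟨ det-expand-col A ⟨
    det K A ∎

  punchIn-pinch : ∀ {n} (k : Fin (suc n)) (l : Fin n) → punchIn (punchIn k l) (pinch l k) ≡ k
  punchIn-pinch {suc n} zero l = ≡.refl
  punchIn-pinch {suc n} (suc k) zero = ≡.refl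
  punchIn-pinch {suc n} (suc k) (suc l) = ≡.cong suc (punchIn-pinch k l)

  punchIn-punchIn-pinch : ∀ {n} (k : Fin (suc (suc n))) (l : Fin (suc n)) (c : Fin n) →
    punchIn k (punchIn l c) ≡ punchIn (punchIn k l) (punchIn (pinch l k) c)
  punchIn-punchIn-pinch zero l c = ≡.refl
  punchIn-punchIn-pinch (suc k) zero c = ≡.refl
  punchIn-punchIn-pinch (suc k) (suc l) zero = ≡.refl
  punchIn-punchIn-pinch (suc k) (suc l) (suc c) = ≡.cong suc (punchIn-punchIn-pinch k l c)

  signed-punchIn-pinch : ∀ {n} (k : Fin (suc n)) (l : Fin n) x →
    signed K (toℕ k ℕ.+ toℕ l) x ≈ - signed K (toℕ (punchIn k l) ℕ.+ toℕ (pinch l k)) x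
  signed-punchIn-pinch {suc n} zero l x =
    sym (trans (-‿involutive _) (signed-exponent-cong x (ℕ.+-identityʳ (toℕ l))))
  signed-punchIn-pinch {suc n} (suc k) zero x = -‿cong (signed-exponent-cong x (ℕ.+-identityʳ (toℕ k)))
  signed-punchIn-pinch {suc n} (suc k) (suc l) x = begin
    signed K (suc (toℕ k) ℕ.+ suc (toℕ l)) x
      ≈⟨ signed-suc-+-suc (toℕ k) (toℕ l) x ⟩
    signed K (toℕ k ℕ.+ toℕ l) x
      ≈⟨ signed-punchIn-pinch k l x ⟩
    - signed K (toℕ (punchIn k l) ℕ.+ toℕ (pinch l k)) x
      ≈⟨ -‿cong (signed-suc-+-suc (toℕ (punchIn k l)) (toℕ (pinch l k)) x) ⟨
    - signed K (suc (toℕ (punchIn k l)) ℕ.+ suc (toℕ (pinch l k))) x ∎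

  ∑∑-punchIn-pinch : ∀ {n} (T : Fin (suc n) → Fin n → Carrier) →
    ∑[ k < suc n ] ∑[ l < n ] T k l ≈ ∑[ k < suc n ] ∑[ l < n ] T (punchIn k l) (pinch l k)
  ∑∑-punchIn-pinch {zero} T = refl
  ∑∑-punchIn-pinch {suc n} T = begin
    ∑[ l < suc n ] T zero l + ∑[ k < suc n ] (T (suc k) zero + ∑[ l < n ] T (suc k) (suc l))
      ≈⟨ +-congˡ (∑-distrib-+ (λ k → T (suc k) zero) (λ k → ∑[ l < n ] T (suc k) (suc l))) ⟩
    ∑[ l < suc n ] T zero l + (∑[ k < suc n ] T (suc k) zero + ∑[ k < suc n ] ∑[ l < n ] T (suc k) (suc l))
      ≈⟨ x+[y+z]≈y+[x+z] _ _ _ ⟩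
    ∑[ k < suc n ] T (suc k) zero + (∑[ l < suc n ] T zero l + ∑[ k < suc n ] ∑[ l < n ] T (suc k) (suc l))
      ≈⟨ +-congˡ (+-congˡ (∑∑-punchIn-pinch (λ k l → T (suc k) (suc l)))) ⟩
    ∑[ k < suc n ] T (suc k) zero + (∑[ l < suc n ] T zero l + ∑[ k < suc n ] ∑[ l < n ] T′ k l)
      ≈⟨ +-congˡ (∑-distrib-+ (T zero) (λ k → ∑[ l < n ] T′ k l)) ⟨
    ∑[ k < suc n ] T (suc k) zero + ∑[ k < suc n ] (T zero k + ∑[ l < n ] T′ k l) ∎
    where
    T′ : Fin (suc n) → Fin n → Carrier
    T′ k l = T (suc (punchIn k l)) (suc (pinch l k))

  det-expand₂ : ∀ (x y : Row (suc (suc m))) (R : Fin m → Row (suc (suc m))) →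
    det K (x ∷ y ∷ R) ≈ ∑[ k < suc (suc m) ] ∑[ l < suc m ]
      signed K (toℕ k ℕ.+ toℕ l) (x k * (y (punchIn k l) * det K (λ i c → R i (punchIn k (punchIn l c)))))
  det-expand₂ x y R = trans (det-expand (x ∷ y ∷ R)) (sum-cong-≋ (λ k →
    trans (signed-cong (toℕ k) (*-congˡ {x k} (det-expand (minor (x ∷ y ∷ R) zero k))))
          (signed-*-∑ (toℕ k) (x k) (λ l → y (punchIn k l) * det K (λ i c → R i (punchIn k (punchIn l c)))))))

  -- Expanding along the first two rows, the reindexing (k , l) ↦ (punchIn k l , pinch l k)
  -- turns each term of one side into the negated term of the other.
  det-swap : ∀ (x y : Row (suc (suc m))) (R : Fin m → Row (suc (suc m))) →
    det K (y ∷ x ∷ R) ≈ - det K (x ∷ y ∷ R)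
  det-swap {m} x y R = begin
    det K (y ∷ x ∷ R)
      ≈⟨ det-expand₂ y x R ⟩
    ∑[ k < suc (suc m) ] ∑[ l < suc m ] T′ k l
      ≈⟨ ∑∑-punchIn-pinch T′ ⟩
    ∑[ k < suc (suc m) ] ∑[ l < suc m ] T′ (punchIn k l) (pinch l k)
      ≈⟨ sum-cong-≋ (λ k → sum-cong-≋ (λ l → reindexed k l)) ⟩
    ∑[ k < suc (suc m) ] ∑[ l < suc m ] (- T k l)
      ≈⟨ sum-cong-≋ (λ k → signed-∑ 1 (T k)) ⟨
    ∑[ k < suc (suc m) ] (- ∑[ l < suc m ] T k l)
      ≈⟨ signed-∑ 1 (λ k → ∑[ l < suc m ] T k l) ⟨
    - ∑[ k < suc (suc m) ] ∑[ l < suc m ] T k l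
      ≈⟨ -‿cong (det-expand₂ x y R) ⟨
    - det K (x ∷ y ∷ R) ∎
    where
    D : Fin (suc (suc m)) → Fin (suc m) → Carrier
    D k l = det K (λ i c → R i (punchIn k (punchIn l c)))
    T T′ : Fin (suc (suc m)) → Fin (suc m) → Carrier
    T k l = signed K (toℕ k ℕ.+ toℕ l) (x k * (y (punchIn k l) * D k l))
    T′ k l = signed K (toℕ k ℕ.+ toℕ l) (y k * (x (punchIn k l) * D k l))
    reindexed : ∀ k l → T′ (punchIn k l) (pinch l k) ≈ - T k l
    reindexed k l = begin
      signed K e′ (y (punchIn k l) * (x (punchIn (punchIn k l) (pinch l k)) * D (punchIn k l) (pinch l k)))
        ≈⟨ signed-cong e′ (*-congˡ {y (punchIn k l)} (*-cong
             (reflexive (≡.cong x (punchIn-pinch k l)))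
             (det-cong (λ i c → reflexive (≡.cong (R i) (≡.sym (punchIn-punchIn-pinch k l c))))))) ⟩
      signed K e′ (y (punchIn k l) * (x k * D k l))
        ≈⟨ signed-cong e′ (x∙yz≈y∙xz (y (punchIn k l)) (x k) (D k l)) ⟩
      signed K e′ (x k * (y (punchIn k l) * D k l))
        ≈⟨ -‿involutive _ ⟨
      - - signed K e′ (x k * (y (punchIn k l) * D k l))
        ≈⟨ -‿cong (signed-punchIn-pinch k l _) ⟨
      - T k l ∎
      where e′ = toℕ (punchIn k l) ℕ.+ toℕ (pinch l k)

  mutual
    det-moveToFront : ∀ (p : Fin (suc m)) (N : Matrix (suc m)) →
      det K (N p ∷ N ∘ punchIn p) ≈ signed K (toℕ p) (det K N)
    det-moveToFront zero N = refl
    det-moveToFront {suc m} (suc p) N = begin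
      det K (N (suc p) ∷ N zero ∷ N ∘ suc ∘ punchIn p)
        ≈⟨ det-swap (N zero) (N (suc p)) (N ∘ suc ∘ punchIn p) ⟩
      - det K (N zero ∷ N (suc p) ∷ N ∘ suc ∘ punchIn p)
        ≈⟨ -‿cong (det-moveToSecond p (N zero) (N ∘ suc)) ⟩
      - signed K (toℕ p) (det K N) ∎

    det-moveToSecond : ∀ (p : Fin (suc m)) (x : Row (suc (suc m))) (R : Fin (suc m) → Row (suc (suc m))) →
      det K (x ∷ R p ∷ R ∘ punchIn p) ≈ signed K (toℕ p) (det K (x ∷ R))
    det-moveToSecond {m} p x R = begin
      det K (x ∷ R p ∷ R ∘ punchIn p)
        ≈⟨ det-expand (x ∷ R p ∷ R ∘ punchIn p) ⟩
      ∑[ k < suc (suc m) ] signed K (toℕ k) (x k * det K (Rₖ k p ∷ Rₖ k ∘ punchIn p))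
        ≈⟨ sum-cong-≋ (λ k → signed-cong (toℕ k) (*-congˡ {x k} (det-moveToFront p (Rₖ k)))) ⟩
      ∑[ k < suc (suc m) ] signed K (toℕ k) (x k * signed K (toℕ p) (det K (Rₖ k)))
        ≈⟨ ∑-*-signed (toℕ p) x (λ k → det K (Rₖ k)) ⟩
      signed K (toℕ p) (∑[ k < suc (suc m) ] signed K (toℕ k) (x k * det K (Rₖ k)))
        ≈⟨ signed-cong (toℕ p) (det-expand (x ∷ R)) ⟨
      signed K (toℕ p) (det K (x ∷ R)) ∎
      where
      Rₖ : Fin (suc (suc m)) → Matrix (suc m)
      Rₖ = minor (x ∷ R) zero

  det-x∷x∷R≈0 : ∀ (x : Row (suc (suc m))) R → det K (x ∷ x ∷ R) ≈ 0#
  det-x∷x∷R≈0 x R = x≈-x⇒x≈0 (det-swap x x R)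

  det-repeatedRow : ∀ (R : Fin (suc m) → Row (suc (suc m))) j → det K (R j ∷ R) ≈ 0#
  det-repeatedRow R j = begin
    det K (R j ∷ R)                                              ≈⟨ signed-involutive (toℕ j) _ ⟨
    signed K (toℕ j) (signed K (toℕ j) (det K (R j ∷ R)))        ≈⟨ signed-cong (toℕ j) (det-moveToSecond j (R j) R) ⟨
    signed K (toℕ j) (det K (R j ∷ R j ∷ R ∘ punchIn j))        ≈⟨ signed-cong (toℕ j) (det-x∷x∷R≈0 (R j) (R ∘ punchIn j)) ⟩
    signed K (toℕ j) 0#                                          ≈⟨ signed-0 (toℕ j) ⟩
    0#                                                           ∎

  -- The sum is the column expansion of a matrix whose first column repeats column i of V.
  det-alienCofactor : ∀ (V : Fin (suc (suc m)) → Row (suc m)) (i : Fin (suc m)) →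
    ∑[ k < suc (suc m) ] signed K (toℕ k) (V k i * det K (V ∘ punchIn k)) ≈ 0#
  det-alienCofactor {m} V i = begin
    ∑[ k < suc (suc m) ] signed K (toℕ k) (V k i * det K (V ∘ punchIn k))  ≈⟨ det-expand-col W ⟨
    det K W                                                                ≈⟨ det-transpose W ⟨
    det K (λ a b → W b a)                                                  ≈⟨ det-repeatedRow (λ c b → V b c) i ⟩
    0#                                                                     ∎
    where
    W : Matrix (suc (suc m))
    W r = V r i ∷ V r

  -- Expanding det (V k ∷ R) along its first row turns the sum into alien cofactor sums of V.
  grassmann-plücker : ∀ (V : Fin (suc (suc m)) → Row (suc m)) (R : Fin m → Row (suc m)) →
    ∑[ k < suc (suc m) ] signed K (toℕ k) (det K (V k ∷ R) * det K (V ∘ punchIn k)) ≈ 0#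
  grassmann-plücker {m} V R = begin
    ∑[ k < suc (suc m) ] signed K (toℕ k) (det K (V k ∷ R) * D k)
      ≈⟨ sum-cong-≋ (λ k → signed-cong (toℕ k) (trans (*-comm _ (D k)) (*-congˡ {D k} (det-expand (V k ∷ R))))) ⟩
    ∑[ k < suc (suc m) ] signed K (toℕ k) (D k * ∑[ j < suc m ] signed K (toℕ j) (V k j * E j))
      ≈⟨ sum-cong-≋ (λ k → signed-*-∑ (toℕ k) (D k) (λ j → V k j * E j)) ⟩
    ∑[ k < suc (suc m) ] ∑[ j < suc m ] signed K (toℕ k ℕ.+ toℕ j) (D k * (V k j * E j))
      ≈⟨ ∑-comm (λ k j → signed K (toℕ k ℕ.+ toℕ j) (D k * (V k j * E j))) ⟩
    ∑[ j < suc m ] ∑[ k < suc (suc m) ] signed K (toℕ k ℕ.+ toℕ j) (D k * (V k j * E j))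
      ≈⟨ sum-cong-≋ (λ j → sum-cong-≋ (λ k → trans
           (signed-exponent-cong (D k * (V k j * E j)) (ℕ.+-comm (toℕ k) (toℕ j)))
           (signed-cong (toℕ j ℕ.+ toℕ k) (x∙yz≈z∙yx (D k) (V k j) (E j))))) ⟩
    ∑[ j < suc m ] ∑[ k < suc (suc m) ] signed K (toℕ j ℕ.+ toℕ k) (E j * (V k j * D k))
      ≈⟨ sum-cong-≋ (λ j → signed-*-∑ (toℕ j) (E j) (λ k → V k j * D k)) ⟨
    ∑[ j < suc m ] signed K (toℕ j) (E j * ∑[ k < suc (suc m) ] signed K (toℕ k) (V k j * D k))
      ≈⟨ sum-cong-≋ (λ j → trans (signed-cong (toℕ j) (trans (*-congˡ {E j} (det-alienCofactor V j)) (zeroʳ (E j))))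
                                 (signed-0 (toℕ j))) ⟩
    ∑[ j < suc m ] 0#
      ≈⟨ sum-replicate-zero (suc m) ⟩
    0# ∎
    where
    D : Fin (suc (suc m)) → Carrier
    D k = det K (V ∘ punchIn k)
    E : Fin (suc m) → Carrier
    E j = det K (λ r c → R r (punchIn j c))

  -- Of the Grassmann–Plücker sum for V = b ∷ c ∷ d ∷ Z and R = a ∷ Z only the first three
  -- terms survive; the others contain a repeated row.
  plücker : ∀ {t} (a b c d : Row (suc (suc t))) (Z : Fin t → Row (suc (suc t))) →
    det K (a ∷ c ∷ Z) * det K (b ∷ d ∷ Z) ≈
      det K (a ∷ b ∷ Z) * det K (c ∷ d ∷ Z) + det K (a ∷ d ∷ Z) * det K (b ∷ c ∷ Z)
  plücker {t} a b c d Z = x∙y⁻¹≈ε⇒x≈y v (u + w) (begin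
    v - (u + w)             ≈⟨ +-congˡ (-‿+-comm u w) ⟨
    v + (- u + - w)         ≈⟨ x+[y+z]≈y+[x+z] v (- u) (- w) ⟩
    - u + (v + - w)         ≈⟨ +-congˡ (+-congˡ (+-identityʳ (- w))) ⟨
    - u + (v + (- w + 0#))  ≈⟨ +-cong term₀ (+-cong term₁ (+-cong term₂ tail≈0)) ⟨
    ∑[ k < suc (suc (suc t)) ] signed K (toℕ k) (det K (V k ∷ a ∷ Z) * det K (V ∘ punchIn k))
                            ≈⟨ grassmann-plücker V (a ∷ Z) ⟩
    0#                      ∎)
    where
    P : Row (suc (suc t)) → Row (suc (suc t)) → Carrier
    P x y = det K (x ∷ y ∷ Z)
    u v w : Carrier
    u = P a b * P c d
    v = P a c * P b d
    w = P a d * P b c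
    V : Fin (suc (suc (suc t))) → Row (suc (suc t))
    V = b ∷ c ∷ d ∷ Z

    term₀ : P b a * P c d ≈ - u
    term₀ = trans (*-congʳ (det-swap a b Z)) (sym (-‿distribˡ-* (P a b) (P c d)))

    term₁ : - (P c a * P b d) ≈ v
    term₁ = trans (-‿cong (trans (*-congʳ (det-swap a c Z)) (sym (-‿distribˡ-* (P a c) (P b d))))) (-‿involutive v)

    term₂ : - - (P d a * P b c) ≈ - w
    term₂ = trans (-‿involutive _) (trans (*-congʳ (det-swap a d Z)) (sym (-‿distribˡ-* (P a d) (P b c))))

    tail≈0 : ∑[ i < t ] signed K (3 ℕ.+ toℕ i) (det K (Z i ∷ a ∷ Z) * det K (V ∘ punchIn (suc (suc (suc i))))) ≈ 0#
    tail≈0 = trans (sum-cong-≋ (λ i → trans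
        (signed-cong (3 ℕ.+ toℕ i) (trans (*-congʳ (det-repeatedRow (a ∷ Z) (suc i))) (zeroˡ _)))
        (signed-0 (3 ℕ.+ toℕ i))))
      (sum-replicate-zero t)

module Minors {c ℓ₁ ℓ₂} (K : OrderedField c ℓ₁ ℓ₂) where

  open import Data.Nat as ℕ using (ℕ; zero; suc)
  import Data.Nat.Properties as ℕ
  open import Data.Fin using (Fin; zero; suc; toℕ; punchIn; _<_)
  import Data.Fin.Properties as Fin
  open import Data.Fin.Subset using (Subset; _∉_; ∣_∣)
  open import Data.Vec.Functional using (_∷_)
  open import Data.Product using (_×_; _,_; proj₁; proj₂)
  open import Data.Sum as Sum using (_⊎_; inj₁; inj₂)
  open import Function using (_∘_)
  open import Relation.Nullary using (¬_)
  import Relation.Binary.PropositionalEquality as ≡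
  open ≡ using (_≡_; _≢_)

  open OrderedField K hiding (zero)
  open import Algebra.Properties.Ring ring using (-‿involutive)
  open import Algebra.Properties.CommutativeSemigroup ℕ.+-commutativeSemigroup using (interchange)
  open import Relation.Binary.Reasoning.Setoid setoid
  open Subsets
  open Enumeration
  open OrderedFieldFacts K
  open Determinants K

  module _ {r n : ℕ} (A : Fin r → Fin n → Carrier) where

    Δ : (T : Subset n) → ∣ T ∣ ≡ r → Carrier
    Δ T e = det K (λ i j → A i (enum T e j))

    -- ∣ T ∣ ≡ r has at most one proof, so this just says Δ_T ≉ 0.
    NonzeroMinor : Subset n → Set ℓ₁
    NonzeroMinor T = ∀ e → ¬ Δ T e ≈ 0#

    NonzeroMinor-swap : ∀ S x y → NonzeroMinor (S ⊕ x ⊕ y) → NonzeroMinor (S ⊕ y ⊕ x)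
    NonzeroMinor-swap S x y = ≡.subst NonzeroMinor (p⊕x⊕y≡p⊕y⊕x S x y)

  module _ {t n : ℕ} (A : Fin (suc (suc t)) → Fin n → Carrier) where

    column : Fin n → Row (suc (suc t))
    column z i = A i z

    columns : ∀ {m} (T : Subset n) → ∣ T ∣ ≡ m → Fin m → Row (suc (suc t))
    columns T e = column ∘ enum T e

    private
      columns-⊕ : ∀ {m} (T : Subset n) {y} → y ∉ T → (e : ∣ T ∣ ≡ m) (e′ : ∣ T ⊕ y ∣ ≡ suc m) →
        ∀ {p} → enum (T ⊕ y) e′ p ≡ y →
        ∀ i j → (columns (T ⊕ y) e′ p ∷ columns (T ⊕ y) e′ ∘ punchIn p) i j ≈ (column y ∷ columns T e) i j
      columns-⊕ T y∉T e e′ eₚ≡y zero j = reflexive (≡.cong (A j) eₚ≡y)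
      columns-⊕ T y∉T e e′ eₚ≡y (suc k) j = reflexive (≡.cong (A j) (enum-punchIn T y∉T e e′ eₚ≡y k))

    det-columns-⊕ : ∀ (T : Subset n) {y} → y ∉ T → (e : ∣ T ∣ ≡ suc t) (e′ : ∣ T ⊕ y ∣ ≡ suc (suc t)) →
      det K (columns (T ⊕ y) e′) ≈ signed K (countBelow T y) (det K (column y ∷ columns T e))
    det-columns-⊕ T {y} y∉T e e′ with enum-position T e′
    ... | p , eₚ≡y , p≡count = begin
      det K (columns (T ⊕ y) e′)
        ≈⟨ signed-involutive (toℕ p) _ ⟨
      signed K (toℕ p) (signed K (toℕ p) (det K (columns (T ⊕ y) e′)))
        ≈⟨ signed-cong (toℕ p) (det-moveToFront p (columns (T ⊕ y) e′)) ⟨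
      signed K (toℕ p) (det K (columns (T ⊕ y) e′ p ∷ columns (T ⊕ y) e′ ∘ punchIn p))
        ≈⟨ signed-cong (toℕ p) (det-cong (columns-⊕ T y∉T e e′ eₚ≡y)) ⟩
      signed K (toℕ p) (det K (column y ∷ columns T e))
        ≈⟨ signed-exponent-cong _ p≡count ⟩
      signed K (countBelow T y) (det K (column y ∷ columns T e)) ∎

    det-columns-⊕-second : ∀ (x : Row (suc (suc t))) (T : Subset n) {y} → y ∉ T →
      (e : ∣ T ∣ ≡ t) (e′ : ∣ T ⊕ y ∣ ≡ suc t) →
      det K (x ∷ columns (T ⊕ y) e′) ≈ signed K (countBelow T y) (det K (x ∷ column y ∷ columns T e))
    det-columns-⊕-second x T {y} y∉T e e′ with enum-position T e′
    ... | p , eₚ≡y , p≡count = begin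
      det K (x ∷ columns (T ⊕ y) e′)
        ≈⟨ signed-involutive (toℕ p) _ ⟨
      signed K (toℕ p) (signed K (toℕ p) (det K (x ∷ columns (T ⊕ y) e′)))
        ≈⟨ signed-cong (toℕ p) (det-moveToSecond p x (columns (T ⊕ y) e′)) ⟨
      signed K (toℕ p) (det K (x ∷ columns (T ⊕ y) e′ p ∷ columns (T ⊕ y) e′ ∘ punchIn p))
        ≈⟨ signed-cong (toℕ p) (det-cong {A = x ∷ columns (T ⊕ y) e′ p ∷ columns (T ⊕ y) e′ ∘ punchIn p} {B = x ∷ column y ∷ columns T e}
             λ { zero j → refl ; (suc i) j → columns-⊕ T y∉T e e′ eₚ≡y i j }) ⟩
      signed K (toℕ p) (det K (x ∷ column y ∷ columns T e))
        ≈⟨ signed-exponent-cong _ p≡count ⟩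
      signed K (countBelow T y) (det K (x ∷ column y ∷ columns T e)) ∎

    det-columns-⊕⊕ : ∀ (S : Subset n) (eS : ∣ S ∣ ≡ t) {x y} → x < y → x ∉ S → y ∉ S →
      (e : ∣ S ⊕ x ⊕ y ∣ ≡ suc (suc t)) →
      det K (columns (S ⊕ x ⊕ y) e) ≈
        signed K (countBelow S x ℕ.+ countBelow S y) (det K (column x ∷ column y ∷ columns S eS))
    det-columns-⊕⊕ S eS {x} {y} x<y x∉S y∉S e = begin
      det K (columns (S ⊕ x ⊕ y) e)
        ≈⟨ det-columns-⊕ (S ⊕ x) (x∉p⊕y y∉S y≢x) eₓ e ⟩
      signed K (countBelow (S ⊕ x) y) (det K (column y ∷ columns (S ⊕ x) eₓ))
        ≈⟨ signed-exponent-cong _ (countBelow-⊕< S x∉S x<y) ⟩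
      - signed K (countBelow S y) (det K (column y ∷ columns (S ⊕ x) eₓ))
        ≈⟨ -‿cong (signed-cong (countBelow S y) (det-columns-⊕-second (column y) S x∉S eS eₓ)) ⟩
      - signed K cy (signed K cx (det K (column y ∷ column x ∷ columns S eS)))
        ≈⟨ -‿cong (signed-cong cy (signed-cong cx (det-swap (column x) (column y) (columns S eS)))) ⟩
      - signed K cy (signed K cx (- P))
        ≈⟨ -‿cong (signed-cong cy (signed-‿-comm cx P)) ⟩
      - signed K cy (- signed K cx P)
        ≈⟨ trans (-‿cong (signed-‿-comm cy _)) (-‿involutive _) ⟩
      signed K cy (signed K cx P)
        ≈⟨ signed-comm cy cx P ⟩
      signed K cx (signed K cy P)
        ≡⟨ signed-exponent-+ cx cy P ⟨
      signed K (cx ℕ.+ cy) P ∎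
      where
      cx = countBelow S x
      cy = countBelow S y
      P = det K (column x ∷ column y ∷ columns S eS)
      y≢x : y ≢ x
      y≢x = Fin.<⇒≢ x<y ∘ ≡.sym
      eₓ : ∣ S ⊕ x ∣ ≡ suc t
      eₓ = ≡.trans (∣p⊕x∣≡1+∣p∣ S x x∉S) (≡.cong suc eS)

    -- Each minor is a signed determinant with its two distinguished columns in front, and for
    -- w < x < y < z the three products carry the same sign.
    plücker-sorted : ∀ (S : Subset n) (eS : ∣ S ∣ ≡ t) {w x y z} → w < x → x < y → y < z →
      w ∉ S → x ∉ S → y ∉ S → z ∉ S → ∀ e₁ e₂ e₃ e₄ e₅ e₆ →
      det K (columns (S ⊕ w ⊕ y) e₁) * det K (columns (S ⊕ x ⊕ z) e₂) ≈
        det K (columns (S ⊕ w ⊕ x) e₃) * det K (columns (S ⊕ y ⊕ z) e₄) +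
        det K (columns (S ⊕ w ⊕ z) e₅) * det K (columns (S ⊕ x ⊕ y) e₆)
    plücker-sorted S eS {w} {x} {y} {z} w<x x<y y<z w∉S x∉S y∉S z∉S e₁ e₂ e₃ e₄ e₅ e₆ = begin
      det K (columns (S ⊕ w ⊕ y) e₁) * det K (columns (S ⊕ x ⊕ z) e₂)
        ≈⟨ product w<y x<z w∉S y∉S x∉S z∉S e₁ e₂ ⟩
      signed K N (P w y * P x z)
        ≈⟨ signed-cong N (plücker (column w) (column x) (column y) (column z) Z) ⟩
      signed K N (P w x * P y z + P w z * P x y)
        ≈⟨ signed-+ N (P w x * P y z) (P w z * P x y) ⟩
      signed K N (P w x * P y z) + signed K N (P w z * P x y)
        ≈⟨ +-cong (signed-exponent-cong (P w x * P y z) (interchange cw cy cx cz)) (signed-exponent-cong (P w z * P x y) wy-xz≡wz-xy) ⟩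
      signed K ((cw ℕ.+ cx) ℕ.+ (cy ℕ.+ cz)) (P w x * P y z) + signed K ((cw ℕ.+ cz) ℕ.+ (cx ℕ.+ cy)) (P w z * P x y)
        ≈⟨ +-cong (product w<x y<z w∉S x∉S y∉S z∉S e₃ e₄) (product w<z x<y w∉S z∉S x∉S y∉S e₅ e₆) ⟨
      det K (columns (S ⊕ w ⊕ x) e₃) * det K (columns (S ⊕ y ⊕ z) e₄) +
        det K (columns (S ⊕ w ⊕ z) e₅) * det K (columns (S ⊕ x ⊕ y) e₆) ∎
      where
      Z = columns S eS
      P : Fin n → Fin n → Carrier
      P a b = det K (column a ∷ column b ∷ Z)
      cw = countBelow S w
      cx = countBelow S x
      cy = countBelow S y
      cz = countBelow S z
      N = (cw ℕ.+ cy) ℕ.+ (cx ℕ.+ cz)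
      w<y = Fin.<-trans w<x x<y
      x<z = Fin.<-trans x<y y<z
      w<z = Fin.<-trans w<y y<z
      wy-xz≡wz-xy : N ≡ (cw ℕ.+ cz) ℕ.+ (cx ℕ.+ cy)
      wy-xz≡wz-xy = ≡.trans (≡.cong ((cw ℕ.+ cy) ℕ.+_) (ℕ.+-comm cx cz))
                   (≡.trans (interchange cw cy cz cx) (≡.cong ((cw ℕ.+ cz) ℕ.+_) (ℕ.+-comm cy cx)))
      product : ∀ {a b c d} → a < b → c < d → a ∉ S → b ∉ S → c ∉ S → d ∉ S → ∀ eab ecd →
        det K (columns (S ⊕ a ⊕ b) eab) * det K (columns (S ⊕ c ⊕ d) ecd) ≈
          signed K ((countBelow S a ℕ.+ countBelow S b) ℕ.+ (countBelow S c ℕ.+ countBelow S d)) (P a b * P c d)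
      product {a} {b} {c} {d} a<b c<d a∉S b∉S c∉S d∉S eab ecd =
        trans (*-cong (det-columns-⊕⊕ S eS a<b a∉S b∉S eab) (det-columns-⊕⊕ S eS c<d c∉S d∉S ecd))
              (signed-*-signed (countBelow S a ℕ.+ countBelow S b) (countBelow S c ℕ.+ countBelow S d) (P a b) (P c d))

    -- All minors being nonnegative, a vanishing left-hand side would force both products on the
    -- right-hand side to vanish.
    nonzero-sorted : AllMinorsNonneg K A → ∀ (S : Subset n) → ∣ S ∣ ≡ t → ∀ {w x y z} →
      w < x → x < y → y < z → w ∉ S → x ∉ S → y ∉ S → z ∉ S →
      (NonzeroMinor A (S ⊕ w ⊕ x) × NonzeroMinor A (S ⊕ y ⊕ z)) ⊎ (NonzeroMinor A (S ⊕ w ⊕ z) × NonzeroMinor A (S ⊕ x ⊕ y)) →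
      NonzeroMinor A (S ⊕ w ⊕ y) × NonzeroMinor A (S ⊕ x ⊕ z)
    nonzero-sorted nonneg S eS {w} {x} {y} {z} w<x x<y y<z w∉S x∉S y∉S z∉S nonzero =
      (λ e₁ Δ≈0 → proj₁ (*-nonzero⁻ (product≉0 e₁ (card x∉S z∉S x<z))) (trans (sym (Δ≈M _ e₁)) Δ≈0)) ,
      (λ e₂ Δ≈0 → proj₂ (*-nonzero⁻ (product≉0 (card w∉S y∉S w<y) e₂)) (trans (sym (Δ≈M _ e₂)) Δ≈0))
      where
      w<y = Fin.<-trans w<x x<y
      x<z = Fin.<-trans x<y y<z
      w<z = Fin.<-trans w<y y<z
      card : ∀ {a b} → a ∉ S → b ∉ S → a < b → ∣ S ⊕ a ⊕ b ∣ ≡ suc (suc t)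
      card a∉S b∉S a<b = ≡.trans (∣p⊕x⊕y∣≡2+∣p∣ S a∉S b∉S (Fin.<⇒≢ a<b)) (≡.cong (λ k → suc (suc k)) eS)
      M : (T : Subset n) → ∣ T ∣ ≡ suc (suc t) → Carrier
      M T e = det K (columns T e)
      Δ≈M : ∀ T e → Δ A T e ≈ M T e
      Δ≈M T e = det-transpose (columns T e)
      0≤M : ∀ T e → 0# ≤ M T e
      0≤M T e = ≤-respˡʳ-≈ refl (Δ≈M T e) (nonneg (enum T e) (λ _ _ → enum-increasing T e))
      M≉0 : ∀ {T} → NonzeroMinor A T → ∀ e → ¬ M T e ≈ 0#
      M≉0 nz e M≈0 = nz e (trans (Δ≈M _ e) M≈0)
      e₃ = card w∉S x∉S w<x
      e₄ = card y∉S z∉S y<z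
      e₅ = card w∉S z∉S w<z
      e₆ = card x∉S y∉S x<y
      terms≉0 : (¬ M (S ⊕ w ⊕ x) e₃ * M (S ⊕ y ⊕ z) e₄ ≈ 0#) ⊎ (¬ M (S ⊕ w ⊕ z) e₅ * M (S ⊕ x ⊕ y) e₆ ≈ 0#)
      terms≉0 = Sum.map (λ (nz₁ , nz₂) → *-nonzero (M≉0 nz₁ e₃) (M≉0 nz₂ e₄))
                        (λ (nz₁ , nz₂) → *-nonzero (M≉0 nz₁ e₅) (M≉0 nz₂ e₆)) nonzero
      product≉0 : ∀ e₁ e₂ → ¬ M (S ⊕ w ⊕ y) e₁ * M (S ⊕ x ⊕ z) e₂ ≈ 0#
      product≉0 e₁ e₂ product≈0 = nonneg-+-nonzero
        (*-nonneg (0≤M _ e₃) (0≤M _ e₄)) (*-nonneg (0≤M _ e₅) (0≤M _ e₆)) terms≉0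
        (trans (sym (plücker-sorted S eS w<x x<y y<z w∉S x∉S y∉S z∉S e₁ e₂ e₃ e₄ e₅ e₆)) product≈0)

  nonzero-interleaved : ∀ {r n} (A : Fin r → Fin n → Carrier) → AllMinorsNonneg K A →
    ∀ (S : Subset n) → suc (suc ∣ S ∣) ≡ r → ∀ {a b c d} → Interleaved a b c d →
    a ∉ S → b ∉ S → c ∉ S → d ∉ S →
    NonzeroMinor A (S ⊕ a ⊕ b) → NonzeroMinor A (S ⊕ c ⊕ d) → NonzeroMinor A (S ⊕ a ⊕ c)
  nonzero-interleaved A nonneg S ≡.refl {a} {b} {c} {d} (b<a<d<c b<a a<d d<c) a∉S b∉S c∉S d∉S ab cd =
    proj₂ (nonzero-sorted A nonneg S ≡.refl b<a a<d d<c b∉S a∉S d∉S c∉S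
      (inj₁ (NonzeroMinor-swap A S a b ab , NonzeroMinor-swap A S c d cd)))
  nonzero-interleaved A nonneg S ≡.refl {a} {b} {c} {d} (a<d<c<b a<d d<c c<b) a∉S b∉S c∉S d∉S ab cd =
    proj₁ (nonzero-sorted A nonneg S ≡.refl a<d d<c c<b a∉S d∉S c∉S b∉S
      (inj₂ (ab , NonzeroMinor-swap A S c d cd)))
  nonzero-interleaved A nonneg S ≡.refl {a} {b} {c} {d} (b<c<d<a b<c c<d d<a) a∉S b∉S c∉S d∉S ab cd =
    NonzeroMinor-swap A S c a (proj₂ (nonzero-sorted A nonneg S ≡.refl b<c c<d d<a b∉S c∉S d∉S a∉S
      (inj₂ (NonzeroMinor-swap A S a b ab , cd))))
  nonzero-interleaved A nonneg S ≡.refl {a} {b} {c} {d} (c<d<a<b c<d d<a a<b) a∉S b∉S c∉S d∉S ab cd =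
    NonzeroMinor-swap A S c a (proj₁ (nonzero-sorted A nonneg S ≡.refl c<d d<a a<b c∉S d∉S a∉S b∉S
      (inj₁ (cd , ab))))

module Matroids {n : ℕ} (M : Matroid n) where

  open import Data.Nat as ℕ using (suc; _+_; _≤_; _<_)
  import Data.Nat.Properties as ℕ
  open import Data.Nat.Induction using (<-wellFounded)
  open import Induction.WellFounded using (Acc; acc)
  open import Data.Fin using (Fin)
  open import Data.Fin.Properties using (any?; _≟_)
  open import Data.Fin.Subset
  open import Data.Fin.Subset.Properties
  open import Data.Product using (∃; _×_; _,_; proj₁; proj₂)
  open import Data.Sum using (inj₁; inj₂)
  open import Data.Empty using (⊥-elim)
  open import Function using (id; _∘_)
  open import Relation.Nullary using (¬_; Dec; yes; no; ¬?)
  open import Relation.Nullary.Decidable using (_×-dec_; decidable-stable)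
  open import Relation.Binary.PropositionalEquality
  open Subsets

  open Matroid M
  open ℕ.≤-Reasoning

  Independent : Subset n → Set
  Independent X = rk X ≡ ∣ X ∣

  independent? : ∀ X → Dec (Independent X)
  independent? X = rk X ℕ.≟ ∣ X ∣

  infix 4 _∈cl_

  _∈cl_ : Fin n → Subset n → Set
  e ∈cl X = rk (X ⊕ e) ≡ rk X

  record IsBasis (B G : Subset n) : Set where
    field
      B⊆G         : B ⊆ G
      independent : Independent B
      spanning    : rk B ≡ rk G

  Circuit : Subset n → Set
  Circuit C = ¬ Independent C × (∀ {e} → e ∈ C → Independent (C - e))

  independent-⊥ : Independent ⊥
  independent-⊥ = trans (ℕ.n≤0⇒n≡0 (ℕ.≤-trans (rk-bound ⊥) (ℕ.≤-reflexive (∣⊥∣≡0 n)))) (sym (∣⊥∣≡0 n))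

  rk-∪ : ∀ X Y → rk (X ∪ Y) ≤ rk X + rk Y
  rk-∪ X Y = ℕ.≤-trans (ℕ.m≤m+n _ _) (rk-submod X Y)

  rk-⊕ : ∀ X e → rk (X ⊕ e) ≤ suc (rk X)
  rk-⊕ X e = begin
    rk (X ⊕ e)       ≤⟨ rk-∪ X ⁅ e ⁆ ⟩
    rk X + rk ⁅ e ⁆  ≤⟨ ℕ.+-monoʳ-≤ (rk X) (ℕ.≤-trans (rk-bound ⁅ e ⁆) (ℕ.≤-reflexive (∣⁅x⁆∣≡1 e))) ⟩
    rk X + 1         ≡⟨ ℕ.+-comm (rk X) 1 ⟩
    suc (rk X)       ∎

  cl-mono : ∀ {Y Z e} → Y ⊆ Z → e ∈cl Y → e ∈cl Z
  cl-mono {Y} {Z} {e} Y⊆Z e∈clY = ℕ.≤-antisym rk[Z⊕e]≤rkZ (rk-mono Z (Z ⊕ e) (p⊆p∪q ⁅ e ⁆))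
    where
    rk[Z⊕e]≤rkZ : rk (Z ⊕ e) ≤ rk Z
    rk[Z⊕e]≤rkZ = ℕ.+-cancelʳ-≤ (rk Y) _ _ (begin
      rk (Z ⊕ e) + rk Y                    ≤⟨ ℕ.+-mono-≤ (rk-mono _ _ Z⊕e⊆Z∪Y⊕e) (rk-mono _ _ Y⊆Z∩Y⊕e) ⟩
      rk (Z ∪ (Y ⊕ e)) + rk (Z ∩ (Y ⊕ e))  ≤⟨ rk-submod Z (Y ⊕ e) ⟩
      rk Z + rk (Y ⊕ e)                    ≡⟨ cong (rk Z +_) e∈clY ⟩
      rk Z + rk Y                          ∎)
      where
      Z⊕e⊆Z∪Y⊕e : Z ⊕ e ⊆ Z ∪ (Y ⊕ e)
      Z⊕e⊆Z∪Y⊕e = p⊕x⊆q (p⊆p∪q (Y ⊕ e)) (q⊆p∪q Z (Y ⊕ e) (x∈p⊕x Y e))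
      Y⊆Z∩Y⊕e : Y ⊆ Z ∩ (Y ⊕ e)
      Y⊆Z∩Y⊕e y∈Y = x∈p∩q⁺ (Y⊆Z y∈Y , x∈p⇒x∈p⊕y y∈Y)

  basis⇒cl : ∀ {B G} → IsBasis B G → ∀ {e} → e ∈ G → e ∈cl B
  basis⇒cl {B} {G} B-basis {e} e∈G = ℕ.≤-antisym
    (ℕ.≤-trans (rk-mono _ _ (p⊕x⊆q B⊆G e∈G)) (ℕ.≤-reflexive (sym spanning)))
    (rk-mono _ _ (p⊆p∪q ⁅ e ⁆))
    where open IsBasis B-basis

  independent-⊆ : ∀ {X Y} → Independent Y → X ⊆ Y → Independent X
  independent-⊆ {X} {Y} indY X⊆Y = ℕ.≤-antisym (rk-bound X) (ℕ.+-cancelʳ-≤ ∣ Y ─ X ∣ _ _ (begin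
    ∣ X ∣ + ∣ Y ─ X ∣     ≡⟨ ∣q∣≡∣p∣+∣q─p∣ X Y X⊆Y ⟨
    ∣ Y ∣                ≡⟨ indY ⟨
    rk Y                 ≤⟨ rk-mono Y (X ∪ (Y ─ X)) Y⊆X∪Y─X ⟩
    rk (X ∪ (Y ─ X))     ≤⟨ rk-∪ X (Y ─ X) ⟩
    rk X + rk (Y ─ X)    ≤⟨ ℕ.+-monoʳ-≤ (rk X) (rk-bound (Y ─ X)) ⟩
    rk X + ∣ Y ─ X ∣      ∎))
    where
    Y⊆X∪Y─X : Y ⊆ X ∪ (Y ─ X)
    Y⊆X∪Y─X {y} y∈Y with y ∈? X
    ... | yes y∈X = p⊆p∪q (Y ─ X) y∈X
    ... | no y∉X = q⊆p∪q X (Y ─ X) (x∈p∧x∉q⇒x∈p─q y∈Y y∉X)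

  independent-⊕ : ∀ {X e} → Independent X → e ∉ X → ¬ e ∈cl X → Independent (X ⊕ e)
  independent-⊕ {X} {e} indX e∉X e∉clX = begin-equality
    rk (X ⊕ e)  ≡⟨ ℕ.≤-antisym (rk-⊕ X e) (ℕ.≤∧≢⇒< (rk-mono X (X ⊕ e) (p⊆p∪q ⁅ e ⁆)) (e∉clX ∘ sym)) ⟩
    suc (rk X)  ≡⟨ cong suc indX ⟩
    suc ∣ X ∣   ≡⟨ ∣p⊕x∣≡1+∣p∣ X e e∉X ⟨
    ∣ X ⊕ e ∣   ∎

  rk-∪-cl : ∀ G A → (∀ {e} → e ∈ G → e ∈cl A) → rk (A ∪ G) ≡ rk A
  rk-∪-cl G A = go A (<-wellFounded ∣ G ─ A ∣)
    where
    go : ∀ A → Acc _<_ ∣ G ─ A ∣ → (∀ {e} → e ∈ G → e ∈cl A) → rk (A ∪ G) ≡ rk A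
    go A (acc rec) G⊆clA with ⊆-or-witness G A
    ... | inj₁ G⊆A = cong rk (⊆-antisym (∪-least id G⊆A) (p⊆p∪q G))
    ... | inj₂ (e , e∈G , e∉A) = begin-equality
      rk (A ∪ G)        ≡⟨ cong rk A∪G≡A⊕e∪G ⟩
      rk ((A ⊕ e) ∪ G)  ≡⟨ go (A ⊕ e) (rec (∣p─q⊕x∣<∣p─q∣ G A e∈G e∉A)) (cl-mono (p⊆p∪q ⁅ e ⁆) ∘ G⊆clA) ⟩
      rk (A ⊕ e)        ≡⟨ G⊆clA e∈G ⟩
      rk A              ∎
      where
      A∪G≡A⊕e∪G : A ∪ G ≡ (A ⊕ e) ∪ G
      A∪G≡A⊕e∪G = ⊆-antisym (∪-least (p⊆p∪q G ∘ x∈p⇒x∈p⊕y) (q⊆p∪q (A ⊕ e) G))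
                            (∪-least (p⊕x⊆q (p⊆p∪q G) (q⊆p∪q A G e∈G)) (q⊆p∪q A G))

  basis-extension : ∀ {G Y} → Y ⊆ G → Independent Y → ∃ λ B → Y ⊆ B × IsBasis B G
  basis-extension {G} {Y} = go Y (<-wellFounded ∣ G ─ Y ∣)
    where
    go : ∀ Y → Acc _<_ ∣ G ─ Y ∣ → Y ⊆ G → Independent Y → ∃ λ B → Y ⊆ B × IsBasis B G
    go Y (acc rec) Y⊆G indY with any? (λ e → e ∈? G ×-dec ¬? (e ∈? Y) ×-dec ¬? (rk (Y ⊕ e) ℕ.≟ rk Y))
    ... | yes (e , e∈G , e∉Y , e∉clY) with go (Y ⊕ e) (rec (∣p─q⊕x∣<∣p─q∣ G Y e∈G e∉Y))
                                            (p⊕x⊆q Y⊆G e∈G) (independent-⊕ indY e∉Y e∉clY)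
    ...   | B , Y⊕e⊆B , B-basis = B , Y⊕e⊆B ∘ x∈p⇒x∈p⊕y , B-basis
    go Y _ Y⊆G indY | no ∄ = Y , id , record
      { B⊆G = Y⊆G ; independent = indY ; spanning = ℕ.≤-antisym (rk-mono Y G Y⊆G) rkG≤rkY }
      where
      G⊆clY : ∀ {e} → e ∈ G → e ∈cl Y
      G⊆clY {e} e∈G with e ∈? Y
      ... | yes e∈Y = cong rk (p⊕x≡p e∈Y)
      ... | no e∉Y = decidable-stable (rk (Y ⊕ e) ℕ.≟ rk Y) (λ e∉clY → ∄ (e , e∈G , e∉Y , e∉clY))
      rkG≤rkY : rk G ≤ rk Y
      rkG≤rkY = ℕ.≤-trans (rk-mono G (Y ∪ G) (q⊆p∪q Y G)) (ℕ.≤-reflexive (rk-∪-cl G Y G⊆clY))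

  circuit-⊆ : ∀ D → ¬ Independent D → ∃ λ C → C ⊆ D × Circuit C
  circuit-⊆ D = go D (<-wellFounded ∣ D ∣)
    where
    go : ∀ D → Acc _<_ ∣ D ∣ → ¬ Independent D → ∃ λ C → C ⊆ D × Circuit C
    go D (acc rec) ¬indD with any? (λ e → e ∈? D ×-dec ¬? (independent? (D - e)))
    ... | yes (e , e∈D , ¬ind) with go (D - e) (rec (x∈p⇒∣p-x∣<∣p∣ e∈D)) ¬ind
    ...   | C , C⊆D-e , C-circuit = C , p─q⊆p D ⁅ e ⁆ ∘ C⊆D-e , C-circuit
    go D _ ¬indD | no ∄ = D , id , ¬indD ,
      λ {e} e∈D → decidable-stable (independent? (D - e)) (λ ¬ind → ∄ (e , e∈D , ¬ind))

  private
    disjoint-bases-dependent : ∀ {G X B₁ B₂} → ConnectedOn rk G → X ⊆ G → Nonempty X → Nonempty (G ─ X) →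
      IsBasis B₁ X → IsBasis B₂ (G ─ X) → ¬ Independent (B₁ ∪ B₂)
    disjoint-bases-dependent {G} {X} {B₁} {B₂} connected X⊆G X≢∅ G─X≢∅ B₁-basis B₂-basis indB₁∪B₂ =
      ℕ.<-irrefl refl (ℕ.<-≤-trans (connected X X⊆G X≢∅ G─X≢∅) (begin
        rk X + rk (G ─ X)    ≡⟨ cong₂ _+_ (trans (sym spanning₁) independent₁) (trans (sym spanning₂) independent₂) ⟩
        ∣ B₁ ∣ + ∣ B₂ ∣       ≡⟨ ∣p∪q∣≡∣p∣+∣q∣ B₁ B₂ (λ x∈B₁ x∈B₂ → proj₂ (x∈p─q⁻ G X (B₂⊆G─X x∈B₂)) (B₁⊆X x∈B₁)) ⟨
        ∣ B₁ ∪ B₂ ∣          ≡⟨ indB₁∪B₂ ⟨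
        rk (B₁ ∪ B₂)         ≤⟨ rk-mono _ _ (∪-least (X⊆G ∘ B₁⊆X) (p─q⊆p G X ∘ B₂⊆G─X)) ⟩
        rk G                 ∎))
      where
      open IsBasis B₁-basis renaming (B⊆G to B₁⊆X; independent to independent₁; spanning to spanning₁)
      open IsBasis B₂-basis renaming (B⊆G to B₂⊆G─X; independent to independent₂; spanning to spanning₂)

  connected⇒crossingCircuit : ∀ {G X} → ConnectedOn rk G → X ⊆ G → Nonempty X → Nonempty (G ─ X) →
    ∃ λ C → C ⊆ G × Circuit C × (∃ λ a → a ∈ C × a ∉ X) × (∃ λ c → c ∈ C × c ∈ X)
  connected⇒crossingCircuit {G} {X} connected X⊆G X≢∅ G─X≢∅
    with basis-extension {X} ⊥⊆ independent-⊥ | basis-extension {G ─ X} ⊥⊆ independent-⊥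
  ... | B₁ , _ , B₁-basis | B₂ , _ , B₂-basis
    with circuit-⊆ (B₁ ∪ B₂) (disjoint-bases-dependent connected X⊆G X≢∅ G─X≢∅ B₁-basis B₂-basis)
  ... | C , C⊆B₁∪B₂ , C-circuit = C , ∪-least (X⊆G ∘ B₁⊆X) (p─q⊆p G X ∘ B₂⊆G─X) ∘ C⊆B₁∪B₂ , C-circuit ,
    outsideX , insideX
    where
    open IsBasis B₁-basis renaming (B⊆G to B₁⊆X; independent to independent₁)
    open IsBasis B₂-basis renaming (B⊆G to B₂⊆G─X; independent to independent₂)
    outsideX : ∃ λ a → a ∈ C × a ∉ X
    outsideX with ⊆-or-witness C B₁
    ... | inj₁ C⊆B₁ = ⊥-elim (proj₁ C-circuit (independent-⊆ independent₁ C⊆B₁))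
    ... | inj₂ (a , a∈C , a∉B₁) with x∈p∪q⁻ B₁ B₂ (C⊆B₁∪B₂ a∈C)
    ...   | inj₁ a∈B₁ = ⊥-elim (a∉B₁ a∈B₁)
    ...   | inj₂ a∈B₂ = a , a∈C , proj₂ (x∈p─q⁻ G X (B₂⊆G─X a∈B₂))
    insideX : ∃ λ c → c ∈ C × c ∈ X
    insideX with ⊆-or-witness C B₂
    ... | inj₁ C⊆B₂ = ⊥-elim (proj₁ C-circuit (independent-⊆ independent₂ C⊆B₂))
    ... | inj₂ (c , c∈C , c∉B₂) with x∈p∪q⁻ B₁ B₂ (C⊆B₁∪B₂ c∈C)
    ...   | inj₁ c∈B₁ = c , c∈C , B₁⊆X c∈B₁
    ...   | inj₂ c∈B₂ = ⊥-elim (c∉B₂ c∈B₂)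

  circuit-cl : ∀ {C x} → Circuit C → x ∈ C → x ∈cl (C - x)
  circuit-cl {C} {x} (C-dependent , C-minimal) x∈C = ℕ.≤-antisym (ℕ.s≤s⁻¹ (begin-strict
    rk (C - x ⊕ x)    ≡⟨ cong rk (p-x⊕x≡p x∈C) ⟩
    rk C              <⟨ ℕ.≤∧≢⇒< (rk-bound C) C-dependent ⟩
    ∣ C ∣             ≡⟨ 1+∣p-x∣≡∣p∣ C x x∈C ⟨
    suc ∣ C - x ∣      ≡⟨ cong suc (C-minimal x∈C) ⟨
    suc (rk (C - x))  ∎)) (rk-mono _ _ (p⊆p∪q ⁅ x ⁆))

  record Exchange (G : Subset n) (x y : Fin n) : Set where
    field
      core    : Subset n
      x∉core  : x ∉ core
      y∉core  : y ∉ core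
      basis-x : IsBasis (core ⊕ x) G
      basis-y : IsBasis (core ⊕ y) G

  basis-exchange : ∀ {B G x y} → IsBasis B G → x ∈ B → y ∈ G → y ∉ B → x ∈cl (B - x ⊕ y) → IsBasis (B - x ⊕ y) G
  basis-exchange {B} {G} {x} {y} B-basis x∈B y∈G y∉B x∈cl = record
    { B⊆G = B-x⊕y⊆G
    ; independent = ℕ.≤-antisym (rk-bound _) (begin
        ∣ B - x ⊕ y ∣   ≡⟨ ∣p⊕x∣≡1+∣p∣ (B - x) y (y∉B ∘ p─q⊆p B ⁅ x ⁆) ⟩
        suc ∣ B - x ∣   ≡⟨ 1+∣p-x∣≡∣p∣ B x x∈B ⟩
        ∣ B ∣           ≡⟨ independent ⟨
        rk B           ≤⟨ rkB≤rk[B-x⊕y] ⟩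
        rk (B - x ⊕ y) ∎)
    ; spanning = ℕ.≤-antisym (rk-mono _ _ B-x⊕y⊆G) (ℕ.≤-trans (ℕ.≤-reflexive (sym spanning)) rkB≤rk[B-x⊕y])
    }
    where
    open IsBasis B-basis
    B-x⊕y⊆G : B - x ⊕ y ⊆ G
    B-x⊕y⊆G = p⊕x⊆q (B⊆G ∘ p─q⊆p B ⁅ x ⁆) y∈G
    B⊆B-x⊕y⊕x : B ⊆ B - x ⊕ y ⊕ x
    B⊆B-x⊕y⊕x {z} z∈B with z ≟ x
    ... | yes refl = x∈p⊕x (B - x ⊕ y) x
    ... | no z≢x = x∈p⇒x∈p⊕y (x∈p⇒x∈p⊕y (x∈p∧x≢y⇒x∈p-y z∈B z≢x))
    rkB≤rk[B-x⊕y] : rk B ≤ rk (B - x ⊕ y)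
    rkB≤rk[B-x⊕y] = ℕ.≤-trans (rk-mono _ _ B⊆B-x⊕y⊕x) (ℕ.≤-reflexive x∈cl)

  circuit⇒exchange : ∀ {G C x y} → C ⊆ G → Circuit C → x ∈ C → y ∈ C → x ≢ y → Exchange G x y
  circuit⇒exchange {G} {C} {x} {y} C⊆G C-circuit x∈C y∈C x≢y
    with basis-extension {G} {C - y} (C⊆G ∘ p─q⊆p C ⁅ y ⁆) (proj₂ C-circuit y∈C)
  ... | B , C-y⊆B , B-basis = record
    { core = B - x
    ; x∉core = λ x∈B-x → proj₂ (x∈p─q⁻ B ⁅ x ⁆ x∈B-x) (x∈⁅x⁆ x)
    ; y∉core = y∉B ∘ p─q⊆p B ⁅ x ⁆
    ; basis-x = subst (λ B′ → IsBasis B′ G) (sym (p-x⊕x≡p x∈B)) B-basis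
    ; basis-y = basis-exchange B-basis x∈B (C⊆G y∈C) y∉B (cl-mono C-x⊆B-x⊕y (circuit-cl C-circuit x∈C))
    }
    where
    open IsBasis B-basis
    C-y⊆B′ : ∀ {z} → z ∈ C → z ≢ y → z ∈ B
    C-y⊆B′ z∈C z≢y = C-y⊆B (x∈p∧x≢y⇒x∈p-y z∈C z≢y)
    x∈B : x ∈ B
    x∈B = C-y⊆B′ x∈C x≢y
    y∉B : y ∉ B
    y∉B y∈B = proj₁ C-circuit (independent-⊆ independent C⊆B)
      where
      C⊆B : C ⊆ B
      C⊆B {z} z∈C with z ≟ y
      ... | yes refl = y∈B
      ... | no z≢y = C-y⊆B′ z∈C z≢y
    C-x⊆B-x⊕y : C - x ⊆ B - x ⊕ y
    C-x⊆B-x⊕y {z} z∈C-x with x∈p─q⁻ C ⁅ x ⁆ z∈C-x | z ≟ y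
    ... | _ , _ | yes refl = x∈p⊕x (B - x) y
    ... | z∈C , z∉⁅x⁆ | no z≢y = x∈p⇒x∈p⊕y (x∈p∧x∉q⇒x∈p─q (C-y⊆B′ z∈C z≢y) z∉⁅x⁆)

  record CrossingExchange (G X : Subset n) : Set where
    field
      a c      : Fin n
      a∈G      : a ∈ G
      a∉X      : a ∉ X
      c∈X      : c ∈ X
      exchange : Exchange G a c

  connected⇒crossingExchange : ∀ {G X} → ConnectedOn rk G → X ⊆ G → Nonempty X → Nonempty (G ─ X) →
    CrossingExchange G X
  connected⇒crossingExchange {G} {X} connected X⊆G X≢∅ G─X≢∅
    with connected⇒crossingCircuit connected X⊆G X≢∅ G─X≢∅
  ... | C , C⊆G , C-circuit , (a , a∈C , a∉X) , (c , c∈C , c∈X) = record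
    { a = a ; c = c ; a∈G = C⊆G a∈C ; a∉X = a∉X ; c∈X = c∈X
    ; exchange = circuit⇒exchange C⊆G C-circuit a∈C c∈C (λ { refl → a∉X c∈X })
    }

  record ExchangeSquare (a b c d : Fin n) : Set where
    field
      S           : Subset n
      a∉S         : a ∉ S
      b∉S         : b ∉ S
      c∉S         : c ∉ S
      d∉S         : d ∉ S
      2+∣S∣≡rank  : suc (suc ∣ S ∣) ≡ rank
      ab-basis    : rk (S ⊕ a ⊕ b) ≡ rank
      cd-basis    : rk (S ⊕ c ⊕ d) ≡ rank
      ac-nonbasis : rk (S ⊕ a ⊕ c) < rank

module Contraction {n : ℕ} (M : Matroid n) (F : Subset n) where

  open import Data.Nat as ℕ using (suc; _+_; _∸_; _≤_; _<_)
  import Data.Nat.Properties as ℕ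
  open import Data.Fin.Subset hiding (Subset)
  open import Data.Fin.Subset.Properties
  open import Data.Product using (_×_; _,_; proj₁; proj₂)
  open import Data.Sum using (inj₁; inj₂)
  open import Function using (_∘_)
  open import Relation.Binary.PropositionalEquality
  open Subsets

  open Matroid M
  open ℕ.≤-Reasoning

  private
    [m∸o]+[n∸o]≡[m+n]∸[o+o] : ∀ {m n o} → o ≤ m → o ≤ n → (m ∸ o) + (n ∸ o) ≡ (m + n) ∸ (o + o)
    [m∸o]+[n∸o]≡[m+n]∸[o+o] {m} {n} {o} o≤m o≤n = begin-equality
      (m ∸ o) + (n ∸ o)  ≡⟨ ℕ.+-∸-comm (n ∸ o) o≤m ⟨
      (m + (n ∸ o)) ∸ o  ≡⟨ cong (_∸ o) (ℕ.+-∸-assoc m o≤n) ⟨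
      (m + n) ∸ o ∸ o    ≡⟨ ℕ.∸-+-assoc (m + n) o o ⟩
      (m + n) ∸ (o + o)  ∎

    rkF≤ : ∀ X → rk F ≤ rk (X ∪ F)
    rkF≤ X = rk-mono F (X ∪ F) (q⊆p∪q X F)

  -- M/F on the whole ground set, the elements of F becoming loops.
  contraction : Matroid n
  contraction = record
    { rk        = λ X → rk (X ∪ F) ∸ rk F
    ; rk-bound  = λ X → ℕ.≤-trans
        (ℕ.m≤n+o⇒m∸n≤o (rk (X ∪ F)) (rk F) (ℕ.≤-trans (rk-∪ X F) (ℕ.≤-reflexive (ℕ.+-comm (rk X) (rk F)))))
        (rk-bound X)
    ; rk-mono   = λ X Y X⊆Y → ℕ.∸-monoˡ-≤ (rk F) (rk-mono _ _ (∪-least (p⊆p∪q F ∘ X⊆Y) (q⊆p∪q Y F)))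
    ; rk-submod = λ X Y → begin
        (rk ((X ∪ Y) ∪ F) ∸ rk F) + (rk ((X ∩ Y) ∪ F) ∸ rk F)
          ≡⟨ [m∸o]+[n∸o]≡[m+n]∸[o+o] (rkF≤ (X ∪ Y)) (rkF≤ (X ∩ Y)) ⟩
        (rk ((X ∪ Y) ∪ F) + rk ((X ∩ Y) ∪ F)) ∸ (rk F + rk F)
          ≤⟨ ℕ.∸-monoˡ-≤ (rk F + rk F) (submodular X Y) ⟩
        (rk (X ∪ F) + rk (Y ∪ F)) ∸ (rk F + rk F)
          ≡⟨ [m∸o]+[n∸o]≡[m+n]∸[o+o] (rkF≤ X) (rkF≤ Y) ⟨
        (rk (X ∪ F) ∸ rk F) + (rk (Y ∪ F) ∸ rk F) ∎
    }
    where
    open Matroids M using (rk-∪)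
    submodular : ∀ X Y → rk ((X ∪ Y) ∪ F) + rk ((X ∩ Y) ∪ F) ≤ rk (X ∪ F) + rk (Y ∪ F)
    submodular X Y = ℕ.≤-trans
      (ℕ.+-mono-≤ (rk-mono _ _ (∪-least (∪-least (p⊆p∪q (Y ∪ F) ∘ p⊆p∪q F) (q⊆p∪q (X ∪ F) (Y ∪ F) ∘ p⊆p∪q F))
                                        (p⊆p∪q (Y ∪ F) ∘ q⊆p∪q X F)))
                  (rk-mono _ _ (∪-least (λ x∈X∩Y → x∈p∩q⁺ (p⊆p∪q F (proj₁ (x∈p∩q⁻ X Y x∈X∩Y)) ,
                                                           p⊆p∪q F (proj₂ (x∈p∩q⁻ X Y x∈X∩Y))))
                                        (λ x∈F → x∈p∩q⁺ (q⊆p∪q X F x∈F , q⊆p∪q Y F x∈F)))))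
      (rk-submod (X ∪ F) (Y ∪ F))

  private
    module M = Matroids M
    module M／F = Matroids contraction

    ∁F∪F≡⊤ : ∁ F ∪ F ≡ ⊤
    ∁F∪F≡⊤ = trans (∪-comm (∁ F) F) (p∪∁p≡⊤ F)

  basis-∪ : ∀ {P Q} → M.IsBasis P F → M／F.IsBasis Q (∁ F) → rk (P ∪ Q) ≡ rank × ∣ P ∪ Q ∣ ≡ rank
  basis-∪ {P} {Q} P-basis Q-basis = rk[P∪Q]≡rank , ∣P∪Q∣≡rank
    where
    open M.IsBasis P-basis renaming (B⊆G to P⊆F; independent to P-independent; spanning to P-spanning)
    open M／F.IsBasis Q-basis renaming (B⊆G to Q⊆∁F; independent to Q-independent; spanning to Q-spanning)
    rk[Q∪F]≡rank : rk (Q ∪ F) ≡ rank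
    rk[Q∪F]≡rank = begin-equality
      rk (Q ∪ F)                    ≡⟨ ℕ.m∸n+n≡m (rkF≤ Q) ⟨
      (rk (Q ∪ F) ∸ rk F) + rk F    ≡⟨ cong (_+ rk F) Q-spanning ⟩
      (rk (∁ F ∪ F) ∸ rk F) + rk F  ≡⟨ ℕ.m∸n+n≡m (rkF≤ (∁ F)) ⟩
      rk (∁ F ∪ F)                  ≡⟨ cong rk ∁F∪F≡⊤ ⟩
      rank                          ∎
    rk[P∪Q]≡rank : rk (P ∪ Q) ≡ rank
    rk[P∪Q]≡rank = ℕ.≤-antisym (rk-mono _ _ ⊆⊤) (begin
      rank              ≡⟨ rk[Q∪F]≡rank ⟨
      rk (Q ∪ F)        ≤⟨ rk-mono _ _ (∪-least (p⊆p∪q F ∘ q⊆p∪q P Q) (q⊆p∪q (P ∪ Q) F)) ⟩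
      rk ((P ∪ Q) ∪ F)  ≡⟨ M.rk-∪-cl F (P ∪ Q) (M.cl-mono (p⊆p∪q Q) ∘ M.basis⇒cl P-basis) ⟩
      rk (P ∪ Q)        ∎)
    ∣P∪Q∣≡rank : ∣ P ∪ Q ∣ ≡ rank
    ∣P∪Q∣≡rank = begin-equality
      ∣ P ∪ Q ∣                   ≡⟨ ∣p∪q∣≡∣p∣+∣q∣ P Q (λ x∈P x∈Q → x∈p⇒x∉∁p (P⊆F x∈P) (Q⊆∁F x∈Q)) ⟩
      ∣ P ∣ + ∣ Q ∣               ≡⟨ cong₂ _+_ (trans (sym P-independent) P-spanning) (sym Q-independent) ⟩
      rk F + (rk (Q ∪ F) ∸ rk F)  ≡⟨ ℕ.m+[n∸m]≡n (rkF≤ Q) ⟩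
      rk (Q ∪ F)                  ≡⟨ rk[Q∪F]≡rank ⟩
      rank                        ∎

  exchangeSquare : ∀ {a b c d} → M.Exchange F a c → M／F.Exchange (∁ F) b d → M.ExchangeSquare a b c d
  exchangeSquare {a} {b} {c} {d} E₁ E₂ = record
    { S = S
    ; a∉S = ∉S a∉J₁ (x∈p⇒x∉∁p a∈F ∘ J₂⊆∁F)
    ; b∉S = b∉S
    ; c∉S = ∉S c∉J₁ (x∈p⇒x∉∁p c∈F ∘ J₂⊆∁F)
    ; d∉S = ∉S (λ d∈J₁ → x∈p⇒x∉∁p (J₁⊆F d∈J₁) d∈∁F) d∉J₂
    ; 2+∣S∣≡rank = 2+∣S∣≡rank
    ; ab-basis = trans (cong rk ([p∪q]⊕x⊕y≡[p⊕x]∪[q⊕y] J₁ J₂ a b)) (proj₁ (basis-∪ J₁⊕a-basis J₂⊕b-basis))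
    ; cd-basis = trans (cong rk ([p∪q]⊕x⊕y≡[p⊕x]∪[q⊕y] J₁ J₂ c d)) (proj₁ (basis-∪ J₁⊕c-basis J₂⊕d-basis))
    ; ac-nonbasis = ac-nonbasis
    }
    where
    open M.Exchange E₁ renaming (core to J₁; x∉core to a∉J₁; y∉core to c∉J₁; basis-x to J₁⊕a-basis; basis-y to J₁⊕c-basis)
    open M／F.Exchange E₂ renaming (core to J₂; x∉core to b∉J₂; y∉core to d∉J₂; basis-x to J₂⊕b-basis; basis-y to J₂⊕d-basis)
    S = J₁ ∪ J₂
    J₁⊕a⊆F = M.IsBasis.B⊆G J₁⊕a-basis
    J₂⊕b⊆∁F = M／F.IsBasis.B⊆G J₂⊕b-basis
    J₁⊆F : J₁ ⊆ F
    J₁⊆F = J₁⊕a⊆F ∘ x∈p⇒x∈p⊕y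
    J₂⊆∁F : J₂ ⊆ ∁ F
    J₂⊆∁F = J₂⊕b⊆∁F ∘ x∈p⇒x∈p⊕y
    a∈F = J₁⊕a⊆F (x∈p⊕x J₁ a)
    c∈F = M.IsBasis.B⊆G J₁⊕c-basis (x∈p⊕x J₁ c)
    b∈∁F = J₂⊕b⊆∁F (x∈p⊕x J₂ b)
    d∈∁F = M／F.IsBasis.B⊆G J₂⊕d-basis (x∈p⊕x J₂ d)
    disjoint : Disjoint J₁ J₂
    disjoint x∈J₁ x∈J₂ = x∈p⇒x∉∁p (J₁⊆F x∈J₁) (J₂⊆∁F x∈J₂)
    ∉S : ∀ {x} → x ∉ J₁ → x ∉ J₂ → x ∉ S
    ∉S x∉J₁ x∉J₂ x∈S with x∈p∪q⁻ J₁ J₂ x∈S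
    ... | inj₁ x∈J₁ = x∉J₁ x∈J₁
    ... | inj₂ x∈J₂ = x∉J₂ x∈J₂
    b∉S : b ∉ S
    b∉S = ∉S (λ b∈J₁ → x∈p⇒x∉∁p (J₁⊆F b∈J₁) b∈∁F) b∉J₂
    2+∣S∣≡rank : suc (suc ∣ S ∣) ≡ rank
    2+∣S∣≡rank = begin-equality
      suc (suc ∣ S ∣)        ≡⟨ ∣p⊕x⊕y∣≡2+∣p∣ S (∉S a∉J₁ (x∈p⇒x∉∁p a∈F ∘ J₂⊆∁F)) b∉S (λ { refl → x∈p⇒x∉∁p a∈F b∈∁F }) ⟨
      ∣ S ⊕ a ⊕ b ∣          ≡⟨ cong ∣_∣ ([p∪q]⊕x⊕y≡[p⊕x]∪[q⊕y] J₁ J₂ a b) ⟩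
      ∣ (J₁ ⊕ a) ∪ (J₂ ⊕ b) ∣ ≡⟨ proj₂ (basis-∪ J₁⊕a-basis J₂⊕b-basis) ⟩
      rank                   ∎
    S⊕a⊕c⊆[J₁⊕a⊕c]∪J₂ : S ⊕ a ⊕ c ⊆ (J₁ ⊕ a ⊕ c) ∪ J₂
    S⊕a⊕c⊆[J₁⊕a⊕c]∪J₂ = p⊕x⊆q (p⊕x⊆q (∪-least (p⊆p∪q J₂ ∘ x∈p⇒x∈p⊕y ∘ x∈p⇒x∈p⊕y) (q⊆p∪q _ J₂))
                                      (p⊆p∪q J₂ (x∈p⇒x∈p⊕y (x∈p⊕x J₁ a))))
                              (p⊆p∪q J₂ (x∈p⊕x (J₁ ⊕ a) c))
    ac-nonbasis : rk (S ⊕ a ⊕ c) < rank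
    ac-nonbasis = begin-strict
      rk (S ⊕ a ⊕ c)          ≤⟨ rk-mono _ _ S⊕a⊕c⊆[J₁⊕a⊕c]∪J₂ ⟩
      rk ((J₁ ⊕ a ⊕ c) ∪ J₂)  ≤⟨ M.rk-∪ (J₁ ⊕ a ⊕ c) J₂ ⟩
      rk (J₁ ⊕ a ⊕ c) + rk J₂ ≤⟨ ℕ.+-mono-≤ (rk-mono _ _ (p⊕x⊆q J₁⊕a⊆F c∈F)) (rk-bound J₂) ⟩
      rk F + ∣ J₂ ∣           ≡⟨ cong (_+ ∣ J₂ ∣) (M.IsBasis.spanning J₁⊕a-basis) ⟨
      rk (J₁ ⊕ a) + ∣ J₂ ∣    ≡⟨ cong (_+ ∣ J₂ ∣) (trans (M.IsBasis.independent J₁⊕a-basis) (∣p⊕x∣≡1+∣p∣ J₁ a a∉J₁)) ⟩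
      suc ∣ J₁ ∣ + ∣ J₂ ∣     ≡⟨ cong suc (∣p∪q∣≡∣p∣+∣q∣ J₁ J₂ disjoint) ⟨
      suc ∣ S ∣               <⟨ ℕ.n<1+n _ ⟩
      suc (suc ∣ S ∣)         ≡⟨ 2+∣S∣≡rank ⟩
      rank                    ∎

module CyclicIntervals {n : ℕ} (pos : Permutation′ n) where

  open import Data.Fin using (Fin; _<_; _≤_)
  import Data.Fin.Properties as Fin
  open import Data.Fin.Properties using (all?; ¬∀⟶∃¬)
  open import Function using (_∘_)
  open import Data.Fin.Subset
  open import Data.Fin.Subset.Properties
  open import Data.Product using (∃₂; _×_; _,_; proj₁; proj₂)
  open import Data.Sum using (_⊎_; inj₁; inj₂)
  open import Data.Empty using (⊥-elim)
  open import Relation.Nullary using (¬_; Dec; yes; no)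
  open import Relation.Nullary.Decidable using (_×-dec_; _⊎-dec_; _→-dec_)
  open import Relation.Binary using (tri<; tri≈; tri>)
  open import Relation.Binary.PropositionalEquality
  open Subsets
  open Enumeration using (Interleaved; b<a<d<c; a<d<c<b; b<c<d<a; c<d<a<b)
  open Positions pos

  infix 4 _≺_ _≺?_

  _≺_ : Fin n → Fin n → Set
  x ≺ y = position x < position y

  _≺?_ : ∀ x y → Dec (x ≺ y)
  x ≺? y = position x Fin.<? position y

  ≺-trans : ∀ {x y z} → x ≺ y → y ≺ z → x ≺ z
  ≺-trans = Fin.<-trans

  ≺-asym : ∀ {x y} → x ≺ y → ¬ y ≺ x
  ≺-asym = Fin.<-asym

  ≺-connex : ∀ {x y} → x ≢ y → x ≺ y ⊎ y ≺ x
  ≺-connex {x} {y} x≢y with Fin.<-cmp (position x) (position y)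
  ... | tri< x≺y _ _ = inj₁ x≺y
  ... | tri≈ _ eq _ = ⊥-elim (x≢y (position-injective eq))
  ... | tri> _ _ y≺x = inj₂ y≺x

  ∈∉⇒≢ : ∀ {A : Subset n} {x y} → x ∈ A → y ∉ A → x ≢ y
  ∈∉⇒≢ {A} x∈A y∉A refl = y∉A x∈A

  Between : Fin n → Fin n → Fin n → Set
  Between a x c = (a ≺ x × x ≺ c) ⊎ (c ≺ x × x ≺ a)

  between? : ∀ a x c → Dec (Between a x c)
  between? a x c = (a ≺? x ×-dec x ≺? c) ⊎-dec (c ≺? x ×-dec x ≺? a)

  between : Fin n → Fin n → Subset n
  between a c = select (λ x → between? a x c)

  private
    IntervalCondition : Subset n → Fin n → Fin n → Fin n → Set
    IntervalCondition A a b x = a ∈ A → b ∈ A → position a ≤ position x → position x ≤ position b → x ∈ A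

    intervalCondition? : ∀ A a b x → Dec (IntervalCondition A a b x)
    intervalCondition? A a b x =
      a ∈? A →-dec b ∈? A →-dec position a Fin.≤? position x →-dec position x Fin.≤? position b →-dec x ∈? A

  interval? : ∀ A → Dec (IsInterval pos A)
  interval? A = all? λ a → all? λ b → all? λ x → intervalCondition? A a b x

  cyclicInterval? : ∀ A → Dec (IsCyclicInterval pos A)
  cyclicInterval? A = interval? A ⊎-dec interval? (∁ A)

  private
    ¬→⇒×¬ : ∀ {a b} {A : Set a} {B : Set b} → Dec A → ¬ (A → B) → A × ¬ B
    ¬→⇒×¬ (yes a) ¬[A→B] = a , λ b → ¬[A→B] (λ _ → b)
    ¬→⇒×¬ (no ¬a) ¬[A→B] = ⊥-elim (¬[A→B] (λ a → ⊥-elim (¬a a)))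

  record Hole (A : Subset n) : Set where
    field
      u v x : Fin n
      u∈A   : u ∈ A
      v∈A   : v ∈ A
      x∉A   : x ∉ A
      u≺x   : u ≺ x
      x≺v   : x ≺ v

  ¬interval⇒hole : ∀ {A} → ¬ IsInterval pos A → Hole A
  ¬interval⇒hole {A} ¬interval
    with ¬∀⟶∃¬ n _ (λ u → all? λ v → all? λ x → intervalCondition? A u v x) ¬interval
  ... | u , ¬∀v with ¬∀⟶∃¬ n _ (λ v → all? λ x → intervalCondition? A u v x) ¬∀v
  ... | v , ¬∀x with ¬∀⟶∃¬ n _ (intervalCondition? A u v) ¬∀x
  ... | x , ¬Q with ¬→⇒×¬ (u ∈? A) ¬Q
  ... | u∈A , ¬Q₁ with ¬→⇒×¬ (v ∈? A) ¬Q₁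
  ... | v∈A , ¬Q₂ with ¬→⇒×¬ (position u Fin.≤? position x) ¬Q₂
  ... | u≤x , ¬Q₃ with ¬→⇒×¬ (position x Fin.≤? position v) ¬Q₃
  ... | x≤v , x∉A = record
    { u = u ; v = v ; x = x ; u∈A = u∈A ; v∈A = v∈A ; x∉A = x∉A
    ; u≺x = Fin.≤∧≢⇒< u≤x (∈∉⇒≢ u∈A x∉A ∘ position-injective)
    ; x≺v = Fin.≤∧≢⇒< x≤v ((∈∉⇒≢ v∈A x∉A ∘ sym) ∘ position-injective)
    }

  record Gap (F : Subset n) : Set where
    field
      g₁ f₁ g₂ f₂ : Fin n
      g₁∉F        : g₁ ∉ F
      g₂∉F        : g₂ ∉ F
      f₁∈F        : f₁ ∈ F
      f₂∈F        : f₂ ∈ F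
      g₁≺f₁       : g₁ ≺ f₁
      f₁≺g₂       : f₁ ≺ g₂
      f₂-outside  : f₂ ≺ g₁ ⊎ g₂ ≺ f₂

  holes⇒gap : ∀ {F} → Hole F → Hole (∁ F) → Gap F
  holes⇒gap {F} h₁ h₂ = choose (≺-connex (∈∉⇒≢ (Hole.u∈A h₁) (x∈∁p⇒x∉p (Hole.u∈A h₂))))
    where
    open Hole h₁ renaming (u to u₁; v to w₁; x to v₁; u∈A to u₁∈F; v∈A to w₁∈F; x∉A to v₁∉F; u≺x to u₁≺v₁; x≺v to v₁≺w₁)
    open Hole h₂ renaming (u to u₂; v to w₂; x to v₂; u∈A to u₂∈∁F; v∈A to w₂∈∁F; x∉A to v₂∉∁F; u≺x to u₂≺v₂; x≺v to v₂≺w₂)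
    choose : u₁ ≺ u₂ ⊎ u₂ ≺ u₁ → Gap F
    choose (inj₁ u₁≺u₂) = record
      { g₁ = u₂ ; f₁ = v₂ ; g₂ = w₂ ; f₂ = u₁
      ; g₁∉F = x∈∁p⇒x∉p u₂∈∁F ; g₂∉F = x∈∁p⇒x∉p w₂∈∁F ; f₁∈F = x∉∁p⇒x∈p v₂∉∁F ; f₂∈F = u₁∈F
      ; g₁≺f₁ = u₂≺v₂ ; f₁≺g₂ = v₂≺w₂ ; f₂-outside = inj₁ u₁≺u₂
      }
    choose (inj₂ u₂≺u₁) = record
      { g₁ = u₂ ; f₁ = u₁ ; g₂ = v₁ ; f₂ = w₁
      ; g₁∉F = x∈∁p⇒x∉p u₂∈∁F ; g₂∉F = v₁∉F ; f₁∈F = u₁∈F ; f₂∈F = w₁∈F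
      ; g₁≺f₁ = u₂≺u₁ ; f₁≺g₂ = u₁≺v₁ ; f₂-outside = inj₂ v₁≺w₁
      }

  ¬cyclicInterval⇒gap : ∀ {F} → ¬ IsCyclicInterval pos F → Gap F
  ¬cyclicInterval⇒gap {F} ¬cyclic = holes⇒gap (¬interval⇒hole {F} (¬cyclic ∘ inj₁)) (¬interval⇒hole {∁ F} (¬cyclic ∘ inj₂))

  between⇒interleaved : ∀ {a b c d} → Between a d c → ¬ Between a b c → b ≢ a → b ≢ c →
    Interleaved (position a) (position b) (position c) (position d)
  between⇒interleaved (inj₁ (a≺d , d≺c)) ¬a-b-c b≢a b≢c with ≺-connex b≢a | ≺-connex b≢c
  ... | inj₁ b≺a | _ = b<a<d<c b≺a a≺d d≺c
  ... | inj₂ a≺b | inj₂ c≺b = a<d<c<b a≺d d≺c c≺b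
  ... | inj₂ a≺b | inj₁ b≺c = ⊥-elim (¬a-b-c (inj₁ (a≺b , b≺c)))
  between⇒interleaved (inj₂ (c≺d , d≺a)) ¬a-b-c b≢a b≢c with ≺-connex b≢c | ≺-connex b≢a
  ... | inj₁ b≺c | _ = b<c<d<a b≺c c≺d d≺a
  ... | inj₂ c≺b | inj₂ a≺b = c<d<a<b c≺d d≺a a≺b
  ... | inj₂ c≺b | inj₁ b≺a = ⊥-elim (¬a-b-c (inj₂ (c≺b , b≺a)))

  module GapSets {F : Subset n} (gap : Gap F) where

    open Gap gap

    X : Subset n
    X = F ∩ between g₁ g₂

    X⊆F : X ⊆ F
    X⊆F = p∩q⊆p F (between g₁ g₂)

    X-nonempty : Nonempty X
    X-nonempty = f₁ , x∈p∩q⁺ (f₁∈F , ∈-select⁺ (λ x → between? g₁ x g₂) (inj₁ (g₁≺f₁ , f₁≺g₂)))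

    F─X-nonempty : Nonempty (F ─ X)
    F─X-nonempty = f₂ , x∈p∧x∉q⇒x∈p─q f₂∈F (f₂∉between ∘ ∈-select⁻ (λ x → between? g₁ x g₂) ∘ proj₂ ∘ x∈p∩q⁻ F (between g₁ g₂))
      where
      f₂∉between : ¬ Between g₁ f₂ g₂
      f₂∉between (inj₁ (g₁≺f₂ , f₂≺g₂)) with f₂-outside
      ... | inj₁ f₂≺g₁ = ≺-asym g₁≺f₂ f₂≺g₁
      ... | inj₂ g₂≺f₂ = ≺-asym f₂≺g₂ g₂≺f₂
      f₂∉between (inj₂ (g₂≺f₂ , f₂≺g₁)) = ≺-asym (≺-trans g₁≺f₁ f₁≺g₂) (≺-trans g₂≺f₂ f₂≺g₁)

    Y : Fin n → Fin n → Subset n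
    Y a c = ∁ F ∩ between a c

    Y-interleaved : ∀ {a b c d} → a ∈ F → c ∈ F → b ∈ ∁ F → b ∉ Y a c → d ∈ Y a c →
      Interleaved (position a) (position b) (position c) (position d)
    Y-interleaved {a} {b} {c} {d} a∈F c∈F b∈∁F b∉Y d∈Y = between⇒interleaved
      (∈-select⁻ (λ x → between? a x c) (proj₂ (x∈p∩q⁻ (∁ F) (between a c) d∈Y)))
      (λ a-b-c → b∉Y (x∈p∩q⁺ (b∈∁F , ∈-select⁺ (λ x → between? a x c) a-b-c)))
      (∈∉⇒≢ a∈F (x∈∁p⇒x∉p b∈∁F) ∘ sym)
      (∈∉⇒≢ c∈F (x∈∁p⇒x∉p b∈∁F) ∘ sym)

    module _ {a c} (a∈F : a ∈ F) (a∉X : a ∉ X) (c∈X : c ∈ X) where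

      Y⊆∁F : Y a c ⊆ ∁ F
      Y⊆∁F = p∩q⊆p (∁ F) (between a c)

      private
        g₁≺c≺g₂ : g₁ ≺ c × c ≺ g₂
        g₁≺c≺g₂ with ∈-select⁻ (λ x → between? g₁ x g₂) (proj₂ (x∈p∩q⁻ F (between g₁ g₂) c∈X))
        ... | inj₁ g₁≺c≺g₂ = g₁≺c≺g₂
        ... | inj₂ (g₂≺c , c≺g₁) = ⊥-elim (≺-asym (≺-trans g₁≺f₁ f₁≺g₂) (≺-trans g₂≺c c≺g₁))

        a-outside : a ≺ g₁ ⊎ g₂ ≺ a
        a-outside with ≺-connex (∈∉⇒≢ a∈F g₁∉F) | ≺-connex (∈∉⇒≢ a∈F g₂∉F)
        ... | inj₁ a≺g₁ | _ = inj₁ a≺g₁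
        ... | inj₂ _ | inj₂ g₂≺a = inj₂ g₂≺a
        ... | inj₂ g₁≺a | inj₁ a≺g₂ = ⊥-elim (a∉X (x∈p∩q⁺ (a∈F , ∈-select⁺ (λ x → between? g₁ x g₂) (inj₁ (g₁≺a , a≺g₂)))))

        separated : ∃₂ λ g g′ → g ∉ F × g′ ∉ F × Between a g c × ¬ Between a g′ c
        separated with a-outside
        ... | inj₁ a≺g₁ = g₁ , g₂ , g₁∉F , g₂∉F , inj₁ (a≺g₁ , proj₁ g₁≺c≺g₂) , ¬a-g₂-c
          where
          ¬a-g₂-c : ¬ Between a g₂ c
          ¬a-g₂-c (inj₁ (_ , g₂≺c)) = ≺-asym (proj₂ g₁≺c≺g₂) g₂≺c
          ¬a-g₂-c (inj₂ (_ , g₂≺a)) = ≺-asym (≺-trans g₁≺f₁ f₁≺g₂) (≺-trans g₂≺a a≺g₁)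
        ... | inj₂ g₂≺a = g₂ , g₁ , g₂∉F , g₁∉F , inj₂ (proj₂ g₁≺c≺g₂ , g₂≺a) , ¬a-g₁-c
          where
          ¬a-g₁-c : ¬ Between a g₁ c
          ¬a-g₁-c (inj₁ (a≺g₁ , _)) = ≺-asym (≺-trans g₁≺f₁ f₁≺g₂) (≺-trans g₂≺a a≺g₁)
          ¬a-g₁-c (inj₂ (c≺g₁ , _)) = ≺-asym (proj₁ g₁≺c≺g₂) c≺g₁

      Y-nonempty : Nonempty (Y a c)
      Y-nonempty with separated
      ... | g , _ , g∉F , _ , a-g-c , _ = g , x∈p∩q⁺ (x∉p⇒x∈∁p g∉F , ∈-select⁺ (λ x → between? a x c) a-g-c)

      ∁F─Y-nonempty : Nonempty (∁ F ─ Y a c)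
      ∁F─Y-nonempty with separated
      ... | _ , g′ , _ , g′∉F , _ , ¬a-g′-c =
        g′ , x∈p∧x∉q⇒x∈p─q (x∉p⇒x∈∁p g′∉F) (¬a-g′-c ∘ ∈-select⁻ (λ x → between? a x c) ∘ proj₂ ∘ x∈p∩q⁻ (∁ F) (between a c))

open import Data.Nat as ℕ using (suc)
import Data.Nat.Properties as ℕ
open import Data.Fin using (Fin)
open import Data.Fin.Properties using (any?) renaming (_≟_ to _≟ᶠ_)
open import Data.Fin.Subset hiding (Subset)
open import Data.Fin.Subset.Properties using (⊆-antisym)
open import Data.Product using (_,_)
open import Data.Empty using (⊥-elim)
open import Function using (_∘_)
open import Function.Bundles using (Equivalence)
open import Relation.Nullary using (¬_; yes; no)
open import Relation.Binary.PropositionalEquality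

open Subsets
open Enumeration

module _ {c ℓ₁ ℓ₂} (K : OrderedField c ℓ₁ ℓ₂) {n} (M : Matroid n) (pos : Permutation′ n)
         {A : Fin (Matroid.rank M) → Fin n → OrderedField.Carrier K} (represents : Represents K M pos A) where

  open Matroid M
  open Positions pos
  open Minors K

  image-element∘enum-positions : ∀ T (e : ∣ positions T ∣ ≡ rank) → image K (element ∘ enum (positions T) e) ≡ T
  image-element∘enum-positions T e = ⊆-antisym image⊆T T⊆image
    where
    image⊆T : image K (element ∘ enum (positions T) e) ⊆ T
    image⊆T z∈ with ∈-select⁻ (λ z → any? (λ j → element (enum (positions T) e j) ≟ᶠ z)) z∈
    ... | j , refl = ∈-positions⁻ {T} (enum-∈ (positions T) e j)
    T⊆image : T ⊆ image K (element ∘ enum (positions T) e)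
    T⊆image {z} z∈T with enum-surjective (positions T) e (∈-positions⁺ {T} z∈T)
    ... | j , eⱼ≡position-z = ∈-select⁺ (λ z → any? (λ j → element (enum (positions T) e j) ≟ᶠ z))
      (j , trans (cong element eⱼ≡position-z) (element-position z))

  rank⇒nonzeroMinor : ∀ {T} → rk T ≡ rank → NonzeroMinor A (positions T)
  rank⇒nonzeroMinor {T} rkT≡rank e =
    Equivalence.to (represents (enum (positions T) e) (λ _ _ → enum-increasing (positions T) e))
      (trans (cong rk (image-element∘enum-positions T e)) rkT≡rank)

  nonzeroMinor⇒rank : ∀ {T} → ∣ T ∣ ≡ rank → NonzeroMinor A (positions T) → rk T ≡ rank
  nonzeroMinor⇒rank {T} ∣T∣≡rank nonzero = trans (cong rk (sym (image-element∘enum-positions T e)))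
    (Equivalence.from (represents (enum (positions T) e) (λ _ _ → enum-increasing (positions T) e)) (nonzero e))
    where e = trans (∣positions∣ T) ∣T∣≡rank

  ¬interleaved-exchangeSquare : AllMinorsNonneg K A → ∀ {a b c d} → Matroids.ExchangeSquare M a b c d →
    ¬ Interleaved (position a) (position b) (position c) (position d)
  ¬interleaved-exchangeSquare nonneg {a} {b} {c} {d} square crossing = ℕ.<-irrefl ac-basis ac-nonbasis
    where
    open Matroids.ExchangeSquare square
    positions-⊕⊕ : ∀ x y → positions (S ⊕ x ⊕ y) ≡ positions S ⊕ position x ⊕ position y
    positions-⊕⊕ x y = trans (positions-⊕ (S ⊕ x) y) (cong (_⊕ position y) (positions-⊕ S x))
    nonzero : ∀ {x y} → rk (S ⊕ x ⊕ y) ≡ rank → NonzeroMinor A (positions S ⊕ position x ⊕ position y)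
    nonzero {x} {y} = subst (NonzeroMinor A) (positions-⊕⊕ x y) ∘ rank⇒nonzeroMinor
    ac-nonzero : NonzeroMinor A (positions S ⊕ position a ⊕ position c)
    ac-nonzero = nonzero-interleaved A nonneg (positions S) (trans (cong (suc ∘ suc) (∣positions∣ S)) 2+∣S∣≡rank)
      crossing (∉-positions {S} a∉S) (∉-positions {S} b∉S) (∉-positions {S} c∉S) (∉-positions {S} d∉S)
      (nonzero ab-basis) (nonzero cd-basis)
    ac-basis : rk (S ⊕ a ⊕ c) ≡ rank
    ac-basis = nonzeroMinor⇒rank (trans (∣p⊕x⊕y∣≡2+∣p∣ S a∉S c∉S (interleaved⇒≢ crossing ∘ cong position)) 2+∣S∣≡rank)
      (subst (NonzeroMinor A) (sym (positions-⊕⊕ a c)) ac-nonzero)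

corollary3p4 : ∀ {c ℓ₁ ℓ₂ : Level} (K : OrderedField c ℓ₁ ℓ₂)
    {n : ℕ} (M : Matroid n) (F : Subset n) →
    Loopless M → IsFlat M F →
    RestrictionConnected M F → ContractionConnected M F →
    (pos : Permutation′ n) → IsPositroidOrder K M pos →
    IsCyclicInterval pos F
corollary3p4 K M F _ _ F-connected ∁F-connected pos (A , represents , nonneg) with CyclicIntervals.cyclicInterval? pos F
... | yes F-cyclic = F-cyclic
... | no ¬F-cyclic = ⊥-elim (¬interleaved-exchangeSquare K M pos {A} represents nonneg
  (Contraction.exchangeSquare M F exchange₁ exchange₂) (Y-interleaved a∈F (X⊆F c∈X) b∈∁F b∉Y d∈Y))
  where
  open CyclicIntervals pos
  open GapSets (¬cyclicInterval⇒gap ¬F-cyclic)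
  open Matroids.CrossingExchange (Matroids.connected⇒crossingExchange M F-connected X⊆F X-nonempty F─X-nonempty)
    renaming (a∈G to a∈F; exchange to exchange₁)
  open Matroids.CrossingExchange
    (Matroids.connected⇒crossingExchange (Contraction.contraction M F) ∁F-connected
      (Y⊆∁F a∈F a∉X c∈X) (Y-nonempty a∈F a∉X c∈X) (∁F─Y-nonempty a∈F a∉X c∈X))
    renaming (a to b; c to d; a∈G to b∈∁F; a∉X to b∉Y; c∈X to d∈Y; exchange to exchange₂)
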